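{- Let $p$ be an odd prime, let $0<k<p$, and let $A$ be a $p\times p$ $(0,1)$-matrix that is $k$-left row shifted. Let $\mathbf{b}$ be the first row (row $0$) of $A$ and $|\mathbf{b}|$ the number of $1$'s in $\mathbf{b}$. Then (i) $\mathrm{per}(A)\equiv|\mathbf{b}|\pmod p$, and (ii) $\det(A)\equiv\pm|\mathbf{b}|\pmod p$.
   Context: Rows and columns of a $p\times p$ matrix are indexed by $0,1,\dots,p-1$. For a set $B$ of cells, its $k$-left shift is the set of cells $\{(i,(j-k)\bmod p):(i,j)\in B\}$. A $p\times p$ matrix $A$ is $k$-left row shifted ($0<k<p$) if for each $i=1,\dots,p-1$ the $i$-th row of $A$ equals the $k$-left shift of the $(i-1)$-st row, and the $0$-th row equals the $k$-left shift of the $(p-1)$-st row; equivalently $A_{i,j}=A_{i-1,(j+k)\bmod p}$ for all $i,j$ (row indices mod $p$). $\mathrm{per}$ denotes the permanent. -}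

module Defs where

open import Data.Nat as ℕ using (ℕ; zero; suc; NonZero; >-nonZero⁻¹; _%_)
open import Data.Nat.DivMod using (m%n<n)
open import Data.Fin as Fin using (Fin; toℕ; fromℕ<)
open import Data.Fin.Properties using () renaming (_≟_ to _≟F_)
open import Data.Integer as ℤ using (ℤ; 0ℤ; 1ℤ; -1ℤ)
open import Data.Integer.Properties using () renaming (_≟_ to _≟ℤ_)
open import Data.List using (List; []; _∷_; map; concatMap; filter; length; foldr; allFin)
open import Data.Bool using (T?; Bool; true; false; _∧_; _∨_; not; if_then_else_)
open import Data.Vec.Functional using () renaming (_∷_ to _∷ᵥ_)
open import Data.Sum using (_⊎_)
open import Relation.Nullary.Decidable using (does)
open import Relation.Binary.PropositionalEquality using (_≡_)

Matrix : ℕ → Set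
Matrix n = Fin n → Fin n → ℤ

fzero : ∀ {n} .{{_ : NonZero n}} → Fin n
fzero {n} = fromℕ< (>-nonZero⁻¹ n)

_+mod_ : ∀ {n} .{{_ : NonZero n}} → Fin n → ℕ → Fin n
_+mod_ {n} j k = fromℕ< (m%n<n (toℕ j ℕ.+ k) n)

pred-mod : ∀ {n} .{{_ : NonZero n}} → Fin n → Fin n
pred-mod {n} i = i +mod (n ℕ.∸ 1)

Is01 : ∀ {n} → Matrix n → Set
Is01 {n} A = ∀ (i j : Fin n) → (A i j ≡ 0ℤ) ⊎ (A i j ≡ 1ℤ)

KLeftRowShifted : ∀ {n} .{{_ : NonZero n}} → ℕ → Matrix n → Set
KLeftRowShifted {n} k A = ∀ (i j : Fin n) → A i j ≡ A (pred-mod i) (j +mod k)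

onesInRow0 : ∀ {n} .{{_ : NonZero n}} → Matrix n → ℕ
onesInRow0 {n} A = length (filter (λ j → A fzero j ≟ℤ 1ℤ) (allFin n))

allFuns : ∀ m n → List (Fin m → Fin n)
allFuns zero    n = (λ ()) ∷ []
allFuns (suc m) n = concatMap (λ f → map (λ x → x ∷ᵥ f) (allFin n)) (allFuns m n)

isInjective : ∀ {n} → (Fin n → Fin n) → Bool
isInjective {n} σ =
  foldr _∧_ true (map (λ i → foldr _∧_ true (map (λ j →
      does (i ≟F j) ∨ not (does (σ i ≟F σ j))) (allFin n))) (allFin n))

perms : ∀ n → List (Fin n → Fin n)
perms n = filter (λ σ → T? (isInjective σ)) (allFuns n n)

sumℤ : List ℤ → ℤ
sumℤ = foldr ℤ._+_ 0ℤ

prodℤ : List ℤ → ℤ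
prodℤ = foldr ℤ._*_ 1ℤ

inversions : ∀ {n} → (Fin n → Fin n) → ℕ
inversions {n} σ =
  LA.sum (map (λ i → LA.sum (map (λ j →
      if does (i Fin.<? j) ∧ does (σ j Fin.<? σ i) then 1 else 0) (allFin n))) (allFin n))
  where import Data.Nat.ListAction as LA

sgn : ∀ {n} → (Fin n → Fin n) → ℤ
sgn σ = if does (inversions σ ℕ.% 2 ℕ.≟ 0) then 1ℤ else -1ℤ

per : ∀ {n} → Matrix n → ℤ
per {n} A = sumℤ (map (λ σ → prodℤ (map (λ i → A i (σ i)) (allFin n))) (perms n))

det : ∀ {n} → Matrix n → ℤ
det {n} A = sumℤ (map (λ σ → sgn σ ℤ.* prodℤ (map (λ i → A i (σ i)) (allFin n))) (perms n))

-- Substituting d i = σ i − i(p − k) (indices mod p) for a permutation σ, the shift condition turns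
-- A i (σ i) into b (d i), and a cyclic rotation of d amounts to composing σ with cyclic shifts on
-- both sides, which preserves injectivity and, p being odd, the sign. So per A and det A are sums of
-- a rotation-invariant function over all maps d : ℤ/p → ℤ/p. For p prime the non-constant maps fall
-- into rotation orbits of size p, so such a sum is congruent mod p to its part over the constant maps
-- d = c; these give the permutations i ↦ c + i(p − k), all of the same sign, each contributing b c.

module Submission where

open import Defs
import Algebra.Properties.CommutativeMonoid.Sum as CommutativeMonoidSum
open import Data.Bool using (Bool; true; false; if_then_else_; _∧_; _∨_; not; T?)
open import Data.Fin as Fin using (Fin; toℕ; punchOut)
import Data.Fin.Properties as Fin
open import Data.Fin.Permutation using (Permutation; permutation)
open import Data.Integer as ℤ using (ℤ; +_; _-_; -_; 0ℤ; 1ℤ; -1ℤ; _+_; _*_)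
import Data.Integer.DivMod as ℤDM
open import Data.Integer.Divisibility using (_∣_)
import Data.Integer.Divisibility.Signed as DS
import Data.Integer.Properties as ℤ
open import Data.Integer.Tactic.RingSolver using (solve-∀)
open import Data.List using (List; []; _∷_; map; concatMap; filter; tabulate; allFin; length; _++_; foldr)
import Data.List.Properties as List
open import Data.Nat as ℕ using (ℕ; zero; suc; NonZero; _<_; _%_)
import Data.Nat.DivMod as ℕ
import Data.Nat.Divisibility as ℕ
import Data.Nat.ListAction as ℕL
open import Data.Nat.Primality as ℕ using (Prime)
import Data.Nat.Properties as ℕ
import Data.Nat.Tactic.RingSolver as ℕSolver
open import Data.Product using (_×_; ∃; _,_; proj₁; proj₂)
open import Data.Sum as Sum using (_⊎_; inj₁; inj₂)
open import Data.Vec.Functional using () renaming (_∷_ to _∷ᵥ_)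
open import Function using (_∘_; id; const; flip; case_of_)
open import Function.Definitions using (Injective)
open import Relation.Binary.Bundles using (Setoid)
open import Relation.Binary.Definitions using (tri<; tri≈; tri>)
open import Relation.Binary.PropositionalEquality
  using (_≡_; refl; sym; trans; cong; cong₂; subst; _≗_; module ≡-Reasoning)
import Relation.Binary.Reasoning.Setoid as SetoidReasoning
open import Relation.Nullary using (¬_; yes; no)
open import Relation.Nullary.Decidable using (does; dec-true; dec-false)
open import Relation.Nullary.Negation using (contradiction)
open import Relation.Unary using (Decidable)

𝟙 : Bool → ℤ
𝟙 b = if b then 1ℤ else 0ℤ

δ : ∀ {n} → Fin n → Fin n → ℤ
δ x y = 𝟙 (does (x Fin.≟ y))

δ-refl : ∀ {n} (x : Fin n) → δ x x ≡ 1ℤ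
δ-refl x = cong 𝟙 (dec-true (x Fin.≟ x) refl)

δ-≢ : ∀ {n} {x y : Fin n} → ¬ x ≡ y → δ x y ≡ 0ℤ
δ-≢ {x = x} {y} x≢y = cong 𝟙 (dec-false (x Fin.≟ y) x≢y)

IsPermutation : ∀ {n} → (Fin n → Fin n) → Set
IsPermutation = Injective _≡_ _≡_

sumOver : {A : Set} → List A → (A → ℤ) → ℤ
sumOver []       f = 0ℤ
sumOver (x ∷ xs) f = f x + sumOver xs f

prodOver : {A : Set} → List A → (A → ℤ) → ℤ
prodOver []       f = 1ℤ
prodOver (x ∷ xs) f = f x * prodOver xs f

module _ {A : Set} where

  sumℤ-map : (xs : List A) (f : A → ℤ) → sumℤ (map f xs) ≡ sumOver xs f
  sumℤ-map []       f = refl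
  sumℤ-map (x ∷ xs) f = cong (_+_ (f x)) (sumℤ-map xs f)

  prodℤ-map : (xs : List A) (f : A → ℤ) → prodℤ (map f xs) ≡ prodOver xs f
  prodℤ-map []       f = refl
  prodℤ-map (x ∷ xs) f = cong (_*_ (f x)) (prodℤ-map xs f)

  sumOver-cong : (xs : List A) {f g : A → ℤ} → f ≗ g → sumOver xs f ≡ sumOver xs g
  sumOver-cong []       f≗g = refl
  sumOver-cong (x ∷ xs) f≗g = cong₂ _+_ (f≗g x) (sumOver-cong xs f≗g)

  prodOver-cong : (xs : List A) {f g : A → ℤ} → f ≗ g → prodOver xs f ≡ prodOver xs g
  prodOver-cong []       f≗g = refl
  prodOver-cong (x ∷ xs) f≗g = cong₂ _*_ (f≗g x) (prodOver-cong xs f≗g)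

  sumOver-zero : (xs : List A) → sumOver xs (const 0ℤ) ≡ 0ℤ
  sumOver-zero []       = refl
  sumOver-zero (x ∷ xs) = trans (ℤ.+-identityˡ _) (sumOver-zero xs)

  sumOver-distrib-+ : (xs : List A) (f g : A → ℤ) →
                      sumOver xs (λ x → f x + g x) ≡ sumOver xs f + sumOver xs g
  sumOver-distrib-+ []       f g = refl
  sumOver-distrib-+ (x ∷ xs) f g =
    trans (cong (_+_ (f x + g x)) (sumOver-distrib-+ xs f g)) (interchange (f x) (g x) _ _)
    where
    interchange : ∀ a b c d → a + b + (c + d) ≡ a + c + (b + d)
    interchange = solve-∀

  sumOver-distrib-- : (xs : List A) (f g : A → ℤ) →
                      sumOver xs (λ x → f x - g x) ≡ sumOver xs f - sumOver xs g
  sumOver-distrib-- xs f g =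
    trans (sumOver-distrib-+ xs f (λ x → - g x)) (cong (_+_ (sumOver xs f)) (sumOver-neg xs))
    where
    sumOver-neg : (ys : List A) → sumOver ys (λ x → - g x) ≡ - sumOver ys g
    sumOver-neg []       = refl
    sumOver-neg (y ∷ ys) =
      trans (cong (_+_ (- g y)) (sumOver-neg ys)) (sym (ℤ.neg-distrib-+ (g y) (sumOver ys g)))

  sumOver-*ˡ : (xs : List A) (c : ℤ) (f : A → ℤ) → sumOver xs (λ x → c * f x) ≡ c * sumOver xs f
  sumOver-*ˡ []       c f = sym (ℤ.*-zeroʳ c)
  sumOver-*ˡ (x ∷ xs) c f =
    trans (cong (_+_ (c * f x)) (sumOver-*ˡ xs c f)) (sym (ℤ.*-distribˡ-+ c (f x) (sumOver xs f)))

  sumOver-++ : (xs ys : List A) (f : A → ℤ) → sumOver (xs ++ ys) f ≡ sumOver xs f + sumOver ys f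
  sumOver-++ []       ys f = sym (ℤ.+-identityˡ _)
  sumOver-++ (x ∷ xs) ys f =
    trans (cong (_+_ (f x)) (sumOver-++ xs ys f)) (sym (ℤ.+-assoc (f x) _ _))

  sumOver-filter : {P : A → Set} (P? : Decidable P) (xs : List A) (f : A → ℤ) →
                   sumOver (filter P? xs) f ≡ sumOver xs (λ x → 𝟙 (does (P? x)) * f x)
  sumOver-filter P? []       f = refl
  sumOver-filter P? (x ∷ xs) f with does (P? x)
  ... | true  = cong₂ _+_ (sym (ℤ.*-identityˡ (f x))) (sumOver-filter P? xs f)
  ... | false = trans (sumOver-filter P? xs f) (sym (ℤ.+-identityˡ _))

  length≡sumOver-1 : (xs : List A) → + length xs ≡ sumOver xs (const 1ℤ)
  length≡sumOver-1 []       = refl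
  length≡sumOver-1 (x ∷ xs) = cong (_+_ (1ℤ)) (length≡sumOver-1 xs)

  sum-map≡sumOver : (xs : List A) (f : A → ℕ) → + ℕL.sum (map f xs) ≡ sumOver xs (λ x → + f x)
  sum-map≡sumOver []       f = refl
  sum-map≡sumOver (x ∷ xs) f = cong (_+_ (+ f x)) (sum-map≡sumOver xs f)

module _ {A B : Set} where

  sumOver-map : (g : A → B) (xs : List A) (f : B → ℤ) → sumOver (map g xs) f ≡ sumOver xs (f ∘ g)
  sumOver-map g []       f = refl
  sumOver-map g (x ∷ xs) f = cong (_+_ (f (g x))) (sumOver-map g xs f)

  sumOver-concatMap : (g : A → List B) (xs : List A) (f : B → ℤ) →
                      sumOver (concatMap g xs) f ≡ sumOver xs (λ x → sumOver (g x) f)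
  sumOver-concatMap g []       f = refl
  sumOver-concatMap g (x ∷ xs) f =
    trans (sumOver-++ (g x) (concatMap g xs) f) (cong (_+_ (sumOver (g x) f)) (sumOver-concatMap g xs f))

  sumOver-comm : (xs : List A) (ys : List B) (f : A → B → ℤ) →
                 sumOver xs (λ x → sumOver ys (f x)) ≡ sumOver ys (λ y → sumOver xs (λ x → f x y))
  sumOver-comm []       ys f = sym (sumOver-zero ys)
  sumOver-comm (x ∷ xs) ys f =
    trans (cong (_+_ (sumOver ys (f x))) (sumOver-comm xs ys f))
          (sym (sumOver-distrib-+ ys (f x) (λ y → sumOver xs (λ x → f x y))))

∑ : (n : ℕ) → (Fin n → ℤ) → ℤ
∑ n f = sumOver (allFin n) f

∏ : (n : ℕ) → (Fin n → ℤ) → ℤ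
∏ n f = prodOver (allFin n) f

infix 5 ∑ ∏
syntax ∑ n (λ i → e) = ∑[ i < n ] e
syntax ∏ n (λ i → e) = ∏[ i < n ] e

sumOver-tabulate : ∀ {A : Set} n (g : Fin n → A) (f : A → ℤ) → sumOver (tabulate g) f ≡ ∑ n (f ∘ g)
sumOver-tabulate zero    g f = refl
sumOver-tabulate (suc n) g f =
  cong (_+_ (f (g Fin.zero)))
       (trans (sumOver-tabulate n (g ∘ Fin.suc) f) (sym (sumOver-tabulate n Fin.suc (f ∘ g))))

prodOver-tabulate : ∀ {A : Set} n (g : Fin n → A) (f : A → ℤ) → prodOver (tabulate g) f ≡ ∏ n (f ∘ g)
prodOver-tabulate zero    g f = refl
prodOver-tabulate (suc n) g f =
  cong (_*_ (f (g Fin.zero)))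
       (trans (prodOver-tabulate n (g ∘ Fin.suc) f) (sym (prodOver-tabulate n Fin.suc (f ∘ g))))

∑-suc : ∀ n (f : Fin (suc n) → ℤ) → ∑ (suc n) f ≡ f Fin.zero + ∑ n (f ∘ Fin.suc)
∑-suc n f = cong (_+_ (f Fin.zero)) (sumOver-tabulate n Fin.suc f)

∏-suc : ∀ n (f : Fin (suc n) → ℤ) → ∏ (suc n) f ≡ f Fin.zero * ∏ n (f ∘ Fin.suc)
∏-suc n f = cong (_*_ (f Fin.zero)) (prodOver-tabulate n Fin.suc f)

∑-cong : ∀ n {f g : Fin n → ℤ} → f ≗ g → ∑ n f ≡ ∑ n g
∑-cong n = sumOver-cong (allFin n)

∏-cong : ∀ n {f g : Fin n → ℤ} → f ≗ g → ∏ n f ≡ ∏ n g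
∏-cong n = prodOver-cong (allFin n)

∑-const : ∀ n c → ∑ n (const c) ≡ + n * c
∑-const zero    c = sym (ℤ.*-zeroˡ c)
∑-const (suc n) c = trans (∑-suc n (const c)) (trans (cong (_+_ c) (∑-const n c)) (lemma (+ n) c))
  where
  lemma : ∀ x c → c + x * c ≡ (1ℤ + x) * c
  lemma = solve-∀

∑-δ : ∀ n (c : Fin n) (g : Fin n → ℤ) → ∑[ x < n ] δ x c * g x ≡ g c
∑-δ (suc n) Fin.zero g = begin
  ∑[ x < suc n ] δ x Fin.zero * g x
    ≡⟨ ∑-suc n (λ x → δ x Fin.zero * g x) ⟩
  1ℤ * g Fin.zero + (∑[ x < n ] 0ℤ * g (Fin.suc x))
    ≡⟨ cong₂ _+_ (ℤ.*-identityˡ (g Fin.zero)) (∑-cong n (ℤ.*-zeroˡ ∘ g ∘ Fin.suc)) ⟩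
  g Fin.zero + ∑ n (const 0ℤ)
    ≡⟨ cong (_+_ (g Fin.zero)) (sumOver-zero (allFin n)) ⟩
  g Fin.zero + 0ℤ
    ≡⟨ ℤ.+-identityʳ _ ⟩
  g Fin.zero ∎
  where open ≡-Reasoning
∑-δ (suc n) (Fin.suc c) g = begin
  ∑[ x < suc n ] δ x (Fin.suc c) * g x
    ≡⟨ ∑-suc n (λ x → δ x (Fin.suc c) * g x) ⟩
  0ℤ * g Fin.zero + (∑[ x < n ] δ x c * g (Fin.suc x))
    ≡⟨ cong (_+ (∑[ x < n ] δ x c * g (Fin.suc x))) (ℤ.*-zeroˡ (g Fin.zero)) ⟩
  0ℤ + (∑[ x < n ] δ x c * g (Fin.suc x))
    ≡⟨ ℤ.+-identityˡ _ ⟩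
  ∑[ x < n ] δ x c * g (Fin.suc x)
    ≡⟨ ∑-δ n c (g ∘ Fin.suc) ⟩
  g (Fin.suc c) ∎
  where open ≡-Reasoning

∑-telescope : ∀ n (f : ℕ → ℤ) → ∑[ t < n ] (f (suc (toℕ t)) - f (toℕ t)) ≡ f n - f 0
∑-telescope zero    f = sym (ℤ.+-inverseʳ (f 0))
∑-telescope (suc n) f =
  trans (∑-suc n (λ t → f (suc (toℕ t)) - f (toℕ t)))
      (trans (cong (_+_ (f 1 - f 0)) (∑-telescope n (f ∘ suc))) (lemma (f 0) (f 1) (f (suc n))))
  where
  lemma : ∀ a b c → b - a + (c - b) ≡ c - a
  lemma = solve-∀

injective⇒surjective : ∀ {n} {π : Fin n → Fin n} → IsPermutation π → ∀ y → ∃ λ x → π x ≡ y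
injective⇒surjective {suc n} {π} inj y with Fin.any? (λ x → π x Fin.≟ y)
... | yes hit  = hit
... | no miss =
  let (i , j , i<j , squeezeᵢ≡squeezeⱼ) = Fin.pigeonhole (ℕ.n<1+n n) squeeze
  in  contradiction (inj (Fin.punchOut-injective (avoids i) (avoids j) squeezeᵢ≡squeezeⱼ)) (Fin.<⇒≢ i<j)
  where
  avoids : ∀ x → ¬ y ≡ π x
  avoids x y≡πx = miss (x , sym y≡πx)
  squeeze : Fin (suc n) → Fin n
  squeeze x = punchOut (avoids x)

toPermutation : ∀ {n} {π : Fin n → Fin n} → IsPermutation π → Permutation n n
toPermutation {π = π} inj = permutation π (proj₁ ∘ surj) (proj₂ ∘ surj) (λ x → inj (proj₂ (surj (π x))))
  where surj = injective⇒surjective inj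

module ∑ℤ = CommutativeMonoidSum ℤ.+-0-commutativeMonoid
module ∏ℤ = CommutativeMonoidSum ℤ.*-1-commutativeMonoid

∑-permute : ∀ n (f : Fin n → ℤ) {π : Fin n → Fin n} → IsPermutation π → ∑ n (f ∘ π) ≡ ∑ n f
∑-permute n f {π} inj = trans (∑≡sum n (f ∘ π))
    (trans (sym (∑ℤ.∑-permute f (toPermutation inj))) (sym (∑≡sum n f)))
  where
  ∑≡sum : ∀ n (f : Fin n → ℤ) → ∑ n f ≡ ∑ℤ.sum f
  ∑≡sum zero    f = refl
  ∑≡sum (suc n) f = trans (∑-suc n f) (cong (_+_ (f Fin.zero)) (∑≡sum n (f ∘ Fin.suc)))

∏-permute : ∀ n (f : Fin n → ℤ) {π : Fin n → Fin n} → IsPermutation π → ∏ n (f ∘ π) ≡ ∏ n f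
∏-permute n f {π} inj = trans (∏≡prod n (f ∘ π))
    (trans (sym (∏ℤ.∑-permute f (toPermutation inj))) (sym (∏≡prod n f)))
  where
  ∏≡prod : ∀ n (f : Fin n → ℤ) → ∏ n f ≡ ∏ℤ.sum f
  ∏≡prod zero    f = refl
  ∏≡prod (suc n) f = trans (∏-suc n f) (cong (_*_ (f Fin.zero)) (∏≡prod n (f ∘ Fin.suc)))

∏-𝟙-all : ∀ n (b : Fin n → Bool) → (∀ i → b i ≡ true) → ∏[ i < n ] 𝟙 (b i) ≡ 1ℤ
∏-𝟙-all zero    b all = refl
∏-𝟙-all (suc n) b all =
  trans (∏-suc n (𝟙 ∘ b)) (cong₂ _*_ (cong 𝟙 (all Fin.zero)) (∏-𝟙-all n (b ∘ Fin.suc) (all ∘ Fin.suc)))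

∏-𝟙-false : ∀ n (b : Fin n → Bool) j → b j ≡ false → ∏[ i < n ] 𝟙 (b i) ≡ 0ℤ
∏-𝟙-false (suc n) b Fin.zero    bj≡false =
  trans (∏-suc n (𝟙 ∘ b))
      (trans (cong (λ x → 𝟙 x * ∏ n (𝟙 ∘ b ∘ Fin.suc)) bj≡false) (ℤ.*-zeroˡ (∏ n (𝟙 ∘ b ∘ Fin.suc))))
∏-𝟙-false (suc n) b (Fin.suc j) bj≡false =
  trans (∏-suc n (𝟙 ∘ b)) (trans (cong (_*_ (𝟙 (b Fin.zero))) (∏-𝟙-false n (b ∘ Fin.suc) j bj≡false))
                                 (ℤ.*-zeroʳ (𝟙 (b Fin.zero))))

countTrue : ∀ n → (Fin n → Bool) → ℕ
countTrue zero    b = 0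
countTrue (suc n) b = (if b Fin.zero then 1 else 0) ℕ.+ countTrue n (b ∘ Fin.suc)

∑-𝟙 : ∀ n (b : Fin n → Bool) → ∑[ i < n ] 𝟙 (b i) ≡ + countTrue n b
∑-𝟙 zero    b = refl
∑-𝟙 (suc n) b = trans (∑-suc n (𝟙 ∘ b))
    (trans (cong (_+_ (𝟙 (b Fin.zero))) (∑-𝟙 n (b ∘ Fin.suc))) (head (b Fin.zero)))
  where
  head : ∀ x {c} → 𝟙 x + + c ≡ + ((if x then 1 else 0) ℕ.+ c)
  head true  = refl
  head false = refl

countTrue-positive : ∀ n (b : Fin n → Bool) i → b i ≡ true → 0 < countTrue n b
countTrue-positive (suc n) b Fin.zero    bi≡true rewrite bi≡true = ℕ.s≤s ℕ.z≤n
countTrue-positive (suc n) b (Fin.suc i) bi≡true =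
  ℕ.≤-trans (countTrue-positive n (b ∘ Fin.suc) i bi≡true)
      (ℕ.m≤n+m (countTrue n (b ∘ Fin.suc)) (if b Fin.zero then 1 else 0))

countTrue-≤ : ∀ n (b : Fin n → Bool) → countTrue n b ℕ.≤ n
countTrue-≤ zero    b = ℕ.z≤n
countTrue-≤ (suc n) b with b Fin.zero
... | true  = ℕ.s≤s (countTrue-≤ n (b ∘ Fin.suc))
... | false = ℕ.m≤n⇒m≤1+n (countTrue-≤ n (b ∘ Fin.suc))

countTrue-< : ∀ n (b : Fin n → Bool) j → b j ≡ false → countTrue n b < n
countTrue-< (suc n) b Fin.zero    bj≡false rewrite bj≡false = ℕ.s≤s (countTrue-≤ n (b ∘ Fin.suc))
countTrue-< (suc n) b (Fin.suc j) bj≡false with b Fin.zero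
... | true  = ℕ.s≤s (countTrue-< n (b ∘ Fin.suc) j bj≡false)
... | false = ℕ.m≤n⇒m≤1+n (countTrue-< n (b ∘ Fin.suc) j bj≡false)

Extensional : ∀ {m n} → ((Fin m → Fin n) → ℤ) → Set
Extensional {m} {n} h = ∀ {f g : Fin m → Fin n} → f ≗ g → h f ≡ h g

sumFuns : ∀ m n → ((Fin m → Fin n) → ℤ) → ℤ
sumFuns m n h = sumOver (allFuns m n) h

sumFuns-cong : ∀ m n {h g : (Fin m → Fin n) → ℤ} → h ≗ g → sumFuns m n h ≡ sumFuns m n g
sumFuns-cong m n = sumOver-cong (allFuns m n)

sumFuns-suc : ∀ m n h → sumFuns (suc m) n h ≡ sumFuns m n (λ f → ∑[ x < n ] h (x ∷ᵥ f))
sumFuns-suc m n h =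
  trans (sumOver-concatMap _ (allFuns m n) h) (sumFuns-cong m n (λ f → sumOver-map (_∷ᵥ f) (allFin n) h))

∷ᵥ-cong : ∀ {m n} {h : (Fin (suc m) → Fin n) → ℤ} → Extensional h → ∀ x → Extensional (λ f → h (x ∷ᵥ f))
∷ᵥ-cong h-ext x f≗g = h-ext λ { Fin.zero → refl ; (Fin.suc i) → f≗g i }

sumFuns-reindex : ∀ m n (h : (Fin m → Fin n) → ℤ) → Extensional h →
                  (π : Fin m → Fin n → Fin n) → (∀ i → IsPermutation (π i)) →
                  sumFuns m n h ≡ sumFuns m n (λ f → h (λ i → π i (f i)))
sumFuns-reindex zero    n h h-ext π π-perm = cong (_+ 0ℤ) (h-ext (λ ()))
sumFuns-reindex (suc m) n h h-ext π π-perm = begin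
  sumFuns (suc m) n h
    ≡⟨ sumFuns-suc m n h ⟩
  sumFuns m n (λ f → ∑[ x < n ] h (x ∷ᵥ f))
    ≡⟨ sumFuns-reindex m n _ tail-ext (π ∘ Fin.suc) (π-perm ∘ Fin.suc) ⟩
  sumFuns m n (λ f → ∑[ x < n ] h (x ∷ᵥ πₜ f))
    ≡⟨ sumFuns-cong m n (λ f →
        sym (∑-permute n (λ x → h (x ∷ᵥ πₜ f)) (π-perm Fin.zero))) ⟩
  sumFuns m n (λ f → ∑[ x < n ] h (π Fin.zero x ∷ᵥ πₜ f))
    ≡⟨ sumFuns-cong m n (λ f → ∑-cong n (λ x →
        h-ext λ { Fin.zero → refl ; (Fin.suc i) → refl })) ⟩
  sumFuns m n (λ f → ∑[ x < n ] h (λ i → π i ((x ∷ᵥ f) i)))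
    ≡⟨ sumFuns-suc m n _ ⟨
  sumFuns (suc m) n (λ f → h (λ i → π i (f i))) ∎
  where
  open ≡-Reasoning
  πₜ : (Fin m → Fin n) → Fin m → Fin n
  πₜ f i = π (Fin.suc i) (f i)
  tail-ext : Extensional (λ f → ∑[ x < n ] h (x ∷ᵥ f))
  tail-ext f≗g = ∑-cong n (λ x → ∷ᵥ-cong h-ext x f≗g)

snoc : ∀ {m} {A : Set} → (Fin m → A) → A → Fin (suc m) → A
snoc {zero}  g x _           = x
snoc {suc m} g x Fin.zero    = g Fin.zero
snoc {suc m} g x (Fin.suc i) = snoc (g ∘ Fin.suc) x i

snoc-∘ : ∀ {m} {A B : Set} (F : A → B) (g : Fin m → A) x → F ∘ snoc g x ≗ snoc (F ∘ g) (F x)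
snoc-∘ {zero}  F g x i           = refl
snoc-∘ {suc m} F g x Fin.zero    = refl
snoc-∘ {suc m} F g x (Fin.suc i) = snoc-∘ F (g ∘ Fin.suc) x i

snoc-view : ∀ {m} {A : Set} (g : Fin m → A) x (i : Fin (suc m)) →
            (toℕ i ≡ m × snoc g x i ≡ x) ⊎ (∃ λ j → toℕ j ≡ toℕ i × snoc g x i ≡ g j)
snoc-view {zero}  g x Fin.zero    = inj₁ (refl , refl)
snoc-view {suc m} g x Fin.zero    = inj₂ (Fin.zero , refl , refl)
snoc-view {suc m} g x (Fin.suc i) with snoc-view (g ∘ Fin.suc) x i
... | inj₁ (i≡m , eq)     = inj₁ (cong suc i≡m , eq)
... | inj₂ (j , j≡i , eq) = inj₂ (Fin.suc j , cong suc j≡i , eq)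

sumFuns-snoc : ∀ m n (h : (Fin (suc m) → Fin n) → ℤ) → Extensional h →
               sumFuns (suc m) n h ≡ sumFuns m n (λ g → ∑[ x < n ] h (snoc g x))
sumFuns-snoc zero    n h h-ext =
  trans (sumFuns-suc zero n h)
      (sumFuns-cong zero n (λ f → ∑-cong n (λ x → h-ext {x ∷ᵥ f} {snoc f x} λ { Fin.zero → refl })))
sumFuns-snoc (suc m) n h h-ext = begin
  sumFuns (suc (suc m)) n h
    ≡⟨ sumFuns-suc (suc m) n h ⟩
  sumFuns (suc m) n (λ f → ∑[ x < n ] h (x ∷ᵥ f))
    ≡⟨ sumFuns-snoc m n _ tail-ext ⟩
  sumFuns m n (λ g → ∑[ y < n ] (∑[ x < n ] h (x ∷ᵥ snoc g y)))
    ≡⟨ sumFuns-cong m n (λ g →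
        sumOver-comm (allFin n) (allFin n) _) ⟩
  sumFuns m n (λ g → ∑[ x < n ] (∑[ y < n ] h (x ∷ᵥ snoc g y)))
    ≡⟨ sumFuns-cong m n (λ g → ∑-cong n (λ x →
        ∑-cong n (λ y → h-ext λ { Fin.zero → refl
        ; (Fin.suc i) → refl }))) ⟩
  sumFuns m n (λ g → ∑[ x < n ] (∑[ y < n ] h (snoc (x ∷ᵥ g) y)))
    ≡⟨ sumFuns-suc m n _ ⟨
  sumFuns (suc m) n (λ g → ∑[ y < n ] h (snoc g y)) ∎
  where
  open ≡-Reasoning
  tail-ext : Extensional (λ f → ∑[ x < n ] h (x ∷ᵥ f))
  tail-ext f≗g = ∑-cong n (λ x → ∷ᵥ-cong h-ext x f≗g)

csuc : ∀ {q} → Fin (suc q) → Fin (suc q)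
csuc = snoc Fin.suc Fin.zero

csuc-view : ∀ {q} (i : Fin (suc q)) → (toℕ i ≡ q × csuc i ≡ Fin.zero) ⊎ (toℕ (csuc i) ≡ suc (toℕ i))
csuc-view i with snoc-view Fin.suc Fin.zero i
... | inj₁ last              = inj₁ last
... | inj₂ (j , j≡i , eq)    = inj₂ (trans (cong toℕ eq) (cong suc j≡i))

csuc-injective : ∀ {q} → IsPermutation (csuc {q})
csuc-injective {x = x} {y} eq with csuc-view x | csuc-view y
... | inj₁ (x≡q , _)      | inj₁ (y≡q , _)      = Fin.toℕ-injective (trans x≡q (sym y≡q))
... | inj₁ (_ , x↦0)      | inj₂ y↦suc          = contradiction (trans (sym y↦suc) (cong toℕ (trans (sym eq) x↦0))) λ ()
... | inj₂ x↦suc          | inj₁ (_ , y↦0)      = contradiction (trans (sym x↦suc) (cong toℕ (trans eq y↦0))) λ ()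
... | inj₂ x↦suc          | inj₂ y↦suc          =
  Fin.toℕ-injective (ℕ.suc-injective (trans (sym x↦suc) (trans (cong toℕ eq) y↦suc)))

∷ᵥ-∘-csuc : ∀ {q n} (x : Fin n) (g : Fin q → Fin n) → (x ∷ᵥ g) ∘ csuc ≗ snoc g x
∷ᵥ-∘-csuc x g = snoc-∘ (x ∷ᵥ g) Fin.suc Fin.zero

sumFuns-rotate : ∀ q n (h : (Fin (suc q) → Fin n) → ℤ) → Extensional h →
                 sumFuns (suc q) n (λ d → h (d ∘ csuc)) ≡ sumFuns (suc q) n h
sumFuns-rotate q n h h-ext = begin
  sumFuns (suc q) n (λ d → h (d ∘ csuc))
    ≡⟨ sumFuns-suc q n _ ⟩
  sumFuns q n (λ g → ∑[ x < n ] h ((x ∷ᵥ g) ∘ csuc))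
    ≡⟨ sumFuns-cong q n (λ g → ∑-cong n (λ x → h-ext (∷ᵥ-∘-csuc x g))) ⟩
  sumFuns q n (λ g → ∑[ x < n ] h (snoc g x))
    ≡⟨ sumFuns-snoc q n h h-ext ⟨
  sumFuns (suc q) n h ∎
  where open ≡-Reasoning

δᶠ : ∀ {m n} → (Fin m → Fin n) → (Fin m → Fin n) → ℤ
δᶠ {m} f g = ∏[ i < m ] δ (f i) (g i)

sumFuns-δᶠ : ∀ m n (c : Fin m → Fin n) (h : (Fin m → Fin n) → ℤ) → Extensional h →
             sumFuns m n (λ d → δᶠ d c * h d) ≡ h c
sumFuns-δᶠ zero    n c h h-ext = trans (ℤ.+-identityʳ _) (trans (ℤ.*-identityˡ _) (h-ext (λ ())))
sumFuns-δᶠ (suc m) n c h h-ext = begin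
  sumFuns (suc m) n (λ d → δᶠ d c * h d)
    ≡⟨ sumFuns-suc m n _ ⟩
  sumFuns m n (λ f → ∑[ x < n ] δᶠ (x ∷ᵥ f) c * h (x ∷ᵥ f))
    ≡⟨ sumFuns-cong m n (λ f →
        trans (∑-cong n (λ x → split x f))
        (sumOver-*ˡ (allFin n) (δᶠ f cₜ) _)) ⟩
  sumFuns m n (λ f → δᶠ f cₜ * (∑[ x < n ] δ x c₀ * h (x ∷ᵥ f)))
    ≡⟨ sumFuns-cong m n (λ f →
        cong (_*_ (δᶠ f cₜ)) (∑-δ n c₀ (λ x → h (x ∷ᵥ f)))) ⟩
  sumFuns m n (λ f → δᶠ f cₜ * h (c₀ ∷ᵥ f))
    ≡⟨ sumFuns-δᶠ m n cₜ _ (∷ᵥ-cong h-ext c₀) ⟩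
  h (c₀ ∷ᵥ cₜ)
    ≡⟨ h-ext (λ { Fin.zero → refl ; (Fin.suc i) → refl }) ⟩
  h c ∎
  where
  open ≡-Reasoning
  c₀ = c Fin.zero
  cₜ = c ∘ Fin.suc
  split : ∀ x f → δᶠ (x ∷ᵥ f) c * h (x ∷ᵥ f) ≡ δᶠ f cₜ * (δ x c₀ * h (x ∷ᵥ f))
  split x f = trans (cong (_* h (x ∷ᵥ f)) (∏-suc m (λ i → δ ((x ∷ᵥ f) i) (c i))))
      (rearrange (δ x c₀) (δᶠ f cₜ) (h (x ∷ᵥ f)))
    where
    rearrange : ∀ a b c → a * b * c ≡ b * (a * c)
    rearrange = solve-∀

infix 4 _≡_[mod_]
-- A record rather than plain divisibility, so that a and b remain inferable.
record _≡_[mod_] (a b : ℤ) (p : ℕ) : Set where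
  constructor divides-difference
  field divides : + p DS.∣ a - b
open _≡_[mod_] public

module _ {p : ℕ} where

  ≡mod-refl : ∀ {a} → a ≡ a [mod p ]
  ≡mod-refl {a} = divides-difference (DS.divides 0ℤ (trans (ℤ.+-inverseʳ a) (sym (ℤ.*-zeroˡ (+ p)))))

  ≡mod-reflexive : ∀ {a b} → a ≡ b → a ≡ b [mod p ]
  ≡mod-reflexive refl = ≡mod-refl

  ≡mod-sym : ∀ {a b} → a ≡ b [mod p ] → b ≡ a [mod p ]
  ≡mod-sym {a} {b} (divides-difference p∣a-b) =
    divides-difference (subst (+ p DS.∣_) (negate a b) (DS.∣m⇒∣-m p∣a-b))
    where
    negate : ∀ a b → - (a - b) ≡ b - a
    negate = solve-∀

  ≡mod-trans : ∀ {a b c} → a ≡ b [mod p ] → b ≡ c [mod p ] → a ≡ c [mod p ]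
  ≡mod-trans {a} {b} {c} (divides-difference p∣a-b) (divides-difference p∣b-c) =
    divides-difference (subst (+ p DS.∣_) (chain a b c) (DS.∣m∣n⇒∣m+n p∣a-b p∣b-c))
    where
    chain : ∀ a b c → a - b + (b - c) ≡ a - c
    chain = solve-∀

  ≡mod-+ : ∀ {a b c d} → a ≡ b [mod p ] → c ≡ d [mod p ] → a + c ≡ b + d [mod p ]
  ≡mod-+ {a} {b} {c} {d} (divides-difference p∣a-b) (divides-difference p∣c-d) =
    divides-difference (subst (+ p DS.∣_) (regroup a b c d) (DS.∣m∣n⇒∣m+n p∣a-b p∣c-d))
    where
    regroup : ∀ a b c d → a - b + (c - d) ≡ a + c - (b + d)
    regroup = solve-∀

  ≡mod-*ʳ : ∀ {a b} c → a ≡ b [mod p ] → a * c ≡ b * c [mod p ]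
  ≡mod-*ʳ {a} {b} c (divides-difference p∣a-b) =
    divides-difference (subst (+ p DS.∣_) (distrib a b c) (DS.∣m⇒∣m*n c p∣a-b))
    where
    distrib : ∀ a b c → (a - b) * c ≡ a * c - b * c
    distrib = solve-∀

  ≡mod-+-cancelˡ : ∀ {a b c d} → a ≡ b [mod p ] → a + c ≡ b + d [mod p ] → c ≡ d [mod p ]
  ≡mod-+-cancelˡ {a} {b} {c} {d} (divides-difference p∣a-b) (divides-difference p∣a+c-[b+d]) =
    divides-difference (subst (+ p DS.∣_) (eliminate a b c d) (DS.∣m∣n⇒∣m-n p∣a+c-[b+d] p∣a-b))
    where
    eliminate : ∀ a b c d → a + c - (b + d) - (a - b) ≡ c - d
    eliminate = solve-∀

  multiple≡0 : ∀ m → m * + p ≡ 0ℤ [mod p ]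
  multiple≡0 m = divides-difference (DS.divides m (ℤ.+-identityʳ (m * + p)))

  ≡mod-setoid : Setoid _ _
  ≡mod-setoid = record
    { Carrier = ℤ ; _≈_ = _≡_[mod p ]
    ; isEquivalence = record { refl = ≡mod-refl ; sym = ≡mod-sym ; trans = ≡mod-trans } }

  sumOver-≡mod : {A : Set} (xs : List A) {f g : A → ℤ} → (∀ x → f x ≡ g x [mod p ]) →
                 sumOver xs f ≡ sumOver xs g [mod p ]
  sumOver-≡mod []       f≡g = ≡mod-refl
  sumOver-≡mod (x ∷ xs) f≡g = ≡mod-+ (f≡g x) (sumOver-≡mod xs f≡g)

  ∣-small⇒≡0 : ∀ {r} → r < p → + p DS.∣ + r → r ≡ 0
  ∣-small⇒≡0 {zero}  _   _   = refl
  ∣-small⇒≡0 {suc r} r<p p∣r = contradiction (ℕ.∣⇒≤ (DS.∣⇒∣ᵤ p∣r)) (ℕ.<⇒≱ r<p)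

  ≥-≡mod⇒≡ : ∀ {a b} → b ℕ.≤ a → a < p → + a ≡ + b [mod p ] → a ≡ b
  ≥-≡mod⇒≡ {a} {b} b≤a a<p a≡b = ℕ.≤-antisym (ℕ.m∸n≡0⇒m≤n a∸b≡0) b≤a
    where
    a∸b≡0 : a ℕ.∸ b ≡ 0
    a∸b≡0 = ∣-small⇒≡0 (ℕ.≤-<-trans (ℕ.m∸n≤m a b) a<p)
                        (subst (+ p DS.∣_) (trans (ℤ.m-n≡m⊖n a b) (ℤ.⊖-≥ b≤a)) (divides a≡b))

  small-≡mod⇒≡ : ∀ {a b} → a < p → b < p → + a ≡ + b [mod p ] → a ≡ b
  small-≡mod⇒≡ {a} {b} a<p b<p a≡b with ℕ.≤-total a b
  ... | inj₁ a≤b = sym (≥-≡mod⇒≡ a≤b b<p (≡mod-sym a≡b))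
  ... | inj₂ b≤a = ≥-≡mod⇒≡ b≤a a<p a≡b

  ≡mod-cancelʳ : Prime p → ∀ {a b m} → ¬ (m ≡ 0ℤ [mod p ]) → a * m ≡ b * m [mod p ] → a ≡ b [mod p ]
  ≡mod-cancelʳ p-prime {a} {b} {m} m≢0 (divides-difference p∣am-bm)
    with ℕ.euclidsLemma ℤ.∣ a - b ∣ ℤ.∣ m ∣ p-prime
        (subst (p ℕ.∣_) (ℤ.abs-* (a - b) m) (DS.∣⇒∣ᵤ p∣[a-b]m))
    where
    factor : ∀ a b m → a * m - b * m ≡ (a - b) * m
    factor = solve-∀
    p∣[a-b]m : + p DS.∣ (a - b) * m
    p∣[a-b]m = subst (+ p DS.∣_) (factor a b m) p∣am-bm
  ... | inj₁ p∣a-b = divides-difference (DS.∣ᵤ⇒∣ p∣a-b)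
  ... | inj₂ p∣m   = contradiction (divides-difference (subst (+ p DS.∣_) (sym (ℤ.+-identityʳ m)) (DS.∣ᵤ⇒∣ p∣m)))
      m≢0

module _ {q : ℕ} where

  private
    p = suc q

  %-≡mod : ∀ a → + (a % p) ≡ + a [mod p ]
  %-≡mod a = ≡mod-sym (divides-difference (DS.divides (+ (a ℕ./ p)) (begin
    + a - + (a % p)                         ≡⟨ cong (λ x → + x - + (a % p)) (ℕ.m≡m%n+[m/n]*n a p) ⟩
    + (a % p ℕ.+ a ℕ./ p ℕ.* p) - + (a % p)   ≡⟨ cong (_- + (a % p)) (ℤ.pos-+ (a % p) (a ℕ./ p ℕ.* p)) ⟩
    + (a % p) + + (a ℕ./ p ℕ.* p) - + (a % p) ≡⟨ cancel (+ (a % p)) _ ⟩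
    + (a ℕ./ p ℕ.* p)                         ≡⟨ ℤ.pos-* (a ℕ./ p) p ⟩
    + (a ℕ./ p) * + p                         ∎)))
    where
    open ≡-Reasoning
    cancel : ∀ r x → r + x - r ≡ x
    cancel = solve-∀

  toℕ-+mod : ∀ (x : Fin p) a → toℕ (x +mod a) ≡ (toℕ x ℕ.+ a) % p
  toℕ-+mod x a = Fin.toℕ-fromℕ< (ℕ.m%n<n (toℕ x ℕ.+ a) p)

  toℕ-+mod-≡mod : ∀ (x : Fin p) a → + toℕ (x +mod a) ≡ + toℕ x + + a [mod p ]
  toℕ-+mod-≡mod x a rewrite toℕ-+mod x a | sym (ℤ.pos-+ (toℕ x) a) = %-≡mod (toℕ x ℕ.+ a)

  ≡mod⇒≡ : ∀ {x y : Fin p} → + toℕ x ≡ + toℕ y [mod p ] → x ≡ y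
  ≡mod⇒≡ {x} {y} x≡y = Fin.toℕ-injective (small-≡mod⇒≡ (Fin.toℕ<n x) (Fin.toℕ<n y) x≡y)

  +mod-+mod : ∀ (x : Fin p) a b → (x +mod a) +mod b ≡ x +mod (a ℕ.+ b)
  +mod-+mod x a b = Fin.toℕ-injective (begin
    toℕ ((x +mod a) +mod b)                     ≡⟨ toℕ-+mod (x +mod a) b ⟩
    (toℕ (x +mod a) ℕ.+ b) % p                   ≡⟨ cong (λ r → (r ℕ.+ b) % p) (toℕ-+mod x a) ⟩
    ((toℕ x ℕ.+ a) % p ℕ.+ b) % p                ≡⟨ ℕ.%-distribˡ-+ ((toℕ x ℕ.+ a) % p) b p ⟩
    ((toℕ x ℕ.+ a) % p % p ℕ.+ b % p) % p        ≡⟨ cong (λ r → (r ℕ.+ b % p) % p) (ℕ.m%n%n≡m%n (toℕ x ℕ.+ a) p) ⟩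
    ((toℕ x ℕ.+ a) % p ℕ.+ b % p) % p            ≡⟨ ℕ.%-distribˡ-+ (toℕ x ℕ.+ a) b p ⟨
    (toℕ x ℕ.+ a ℕ.+ b) % p                      ≡⟨ cong (_% p) (ℕ.+-assoc (toℕ x) a b) ⟩
    (toℕ x ℕ.+ (a ℕ.+ b)) % p                    ≡⟨ toℕ-+mod x (a ℕ.+ b) ⟨
    toℕ (x +mod (a ℕ.+ b))                       ∎)
    where open ≡-Reasoning

  +mod-multiple : ∀ (x : Fin p) m → x +mod (p ℕ.* m) ≡ x
  +mod-multiple x m = Fin.toℕ-injective (begin
    toℕ (x +mod (p ℕ.* m))         ≡⟨ toℕ-+mod x (p ℕ.* m) ⟩
    (toℕ x ℕ.+ p ℕ.* m) % p         ≡⟨ cong (λ r → (toℕ x ℕ.+ r) % p) (ℕ.*-comm p m) ⟩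
    (toℕ x ℕ.+ m ℕ.* p) % p         ≡⟨ ℕ.[m+kn]%n≡m%n (toℕ x) m p ⟩
    toℕ x % p                       ≡⟨ ℕ.m<n⇒m%n≡m (Fin.toℕ<n x) ⟩
    toℕ x                           ∎)
    where open ≡-Reasoning

  +mod-zero : ∀ (x : Fin p) → x +mod 0 ≡ x
  +mod-zero x = trans (cong (x +mod_) (sym (ℕ.*-zeroʳ p))) (+mod-multiple x 0)

  +mod-injective : ∀ c → IsPermutation (_+mod c)
  +mod-injective c {x} {y} x+c≡y+c = begin
    x                              ≡⟨ +mod-multiple x c ⟨
    x +mod (c ℕ.+ q ℕ.* c)          ≡⟨ +mod-+mod x c (q ℕ.* c) ⟨
    (x +mod c) +mod (q ℕ.* c)       ≡⟨ cong (_+mod (q ℕ.* c)) x+c≡y+c ⟩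
    (y +mod c) +mod (q ℕ.* c)       ≡⟨ +mod-+mod y c (q ℕ.* c) ⟩
    y +mod (c ℕ.+ q ℕ.* c)          ≡⟨ +mod-multiple y c ⟩
    y                              ∎
    where open ≡-Reasoning

  csuc≡+mod1 : ∀ (i : Fin p) → csuc i ≡ i +mod 1
  csuc≡+mod1 i = Fin.toℕ-injective (trans (csuc-toℕ i) (sym (toℕ-+mod i 1)))
    where
    csuc-toℕ : ∀ i → toℕ (csuc i) ≡ (toℕ i ℕ.+ 1) % p
    csuc-toℕ i with csuc-view i
    ... | inj₁ (i≡q , i↦0) = trans (cong toℕ i↦0) (sym (trans (cong (λ r → (r ℕ.+ 1) % p) i≡q)
                                                             (trans (cong (_% p) (ℕ.+-comm q 1)) (ℕ.n%n≡0 p))))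
    ... | inj₂ i↦suc       = trans i↦suc (sym (trans (cong (_% p) (ℕ.+-comm (toℕ i) 1))
                                                    (ℕ.m<n⇒m%n≡m (subst (_< p) i↦suc (Fin.toℕ<n (csuc i))))))

  +mod-suc : ∀ (x : Fin p) m → x +mod suc m ≡ csuc (x +mod m)
  +mod-suc x m = begin
    x +mod suc m          ≡⟨ cong (x +mod_) (ℕ.+-comm 1 m) ⟩
    x +mod (m ℕ.+ 1)      ≡⟨ +mod-+mod x m 1 ⟨
    (x +mod m) +mod 1     ≡⟨ csuc≡+mod1 (x +mod m) ⟨
    csuc (x +mod m)       ∎
    where open ≡-Reasoning

  +mod-toℕ-csuc : ∀ (x i : Fin p) c → x +mod (toℕ (csuc i) ℕ.* c) ≡ (x +mod (toℕ i ℕ.* c)) +mod c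
  +mod-toℕ-csuc x i c with csuc-view i
  ... | inj₁ (i≡q , i↦0) = begin
    x +mod (toℕ (csuc i) ℕ.* c)          ≡⟨ cong (λ j → x +mod (toℕ j ℕ.* c)) i↦0 ⟩
    x +mod 0                             ≡⟨ +mod-zero x ⟩
    x                                    ≡⟨ +mod-multiple x c ⟨
    x +mod (c ℕ.+ q ℕ.* c)               ≡⟨ cong (x +mod_) (ℕ.+-comm c (q ℕ.* c)) ⟩
    x +mod (q ℕ.* c ℕ.+ c)               ≡⟨ +mod-+mod x (q ℕ.* c) c ⟨
    (x +mod (q ℕ.* c)) +mod c            ≡⟨ cong (λ m → (x +mod (m ℕ.* c)) +mod c) i≡q ⟨
    (x +mod (toℕ i ℕ.* c)) +mod c        ∎
    where open ≡-Reasoning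
  ... | inj₂ i↦suc = begin
    x +mod (toℕ (csuc i) ℕ.* c)          ≡⟨ cong (λ m → x +mod (m ℕ.* c)) i↦suc ⟩
    x +mod (c ℕ.+ toℕ i ℕ.* c)           ≡⟨ cong (x +mod_) (ℕ.+-comm c (toℕ i ℕ.* c)) ⟩
    x +mod (toℕ i ℕ.* c ℕ.+ c)           ≡⟨ +mod-+mod x (toℕ i ℕ.* c) c ⟨
    (x +mod (toℕ i ℕ.* c)) +mod c        ∎
    where open ≡-Reasoning

  toℕ-pred-mod : ∀ (i : Fin p) {m} → toℕ i ≡ suc m → toℕ (pred-mod i) ≡ m
  toℕ-pred-mod i {m} i≡1+m = begin
    toℕ (i +mod q)           ≡⟨ toℕ-+mod i q ⟩
    (toℕ i ℕ.+ q) % p        ≡⟨ cong (λ r → (r ℕ.+ q) % p) i≡1+m ⟩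
    (suc m ℕ.+ q) % p        ≡⟨ cong (_% p) (sym (ℕ.+-suc m q)) ⟩
    (m ℕ.+ p) % p            ≡⟨ ℕ.[m+n]%n≡m%n m p ⟩
    m % p                    ≡⟨ ℕ.m<n⇒m%n≡m m<p ⟩
    m                        ∎
    where
    open ≡-Reasoning
    m<p : m < p
    m<p = ℕ.<-trans (ℕ.n<1+n m) (subst (_< p) i≡1+m (Fin.toℕ<n i))

-- The necklace congruence

module Necklace (q N : ℕ) where

  private
    p = suc q

  Colouring : Set
  Colouring = Fin p → Fin N

  RotationInvariant : (Colouring → ℤ) → Set
  RotationInvariant H = ∀ d → H (d ∘ csuc) ≡ H d

  rotate : ℕ → Colouring → Colouring
  rotate zero    d = d
  rotate (suc j) d = rotate j (d ∘ csuc)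

  rotate-cong : ∀ j {d d′ : Colouring} → d ≗ d′ → rotate j d ≗ rotate j d′
  rotate-cong zero    d≗d′ = d≗d′
  rotate-cong (suc j) d≗d′ = rotate-cong j (d≗d′ ∘ csuc)

  residue : ℤ → Fin p
  residue a = Fin.fromℕ< (ℤDM.n%ℕd<d a p)

  residue-≡mod : ∀ a → + toℕ (residue a) ≡ a [mod p ]
  residue-≡mod a rewrite Fin.toℕ-fromℕ< (ℤDM.n%ℕd<d a p) =
    divides-difference (DS.divides (- (a ℤDM./ℕ p)) (begin
      + (a ℤDM.%ℕ p) - a
        ≡⟨ cong (λ x → + (a ℤDM.%ℕ p) - x) (ℤDM.a≡a%ℕn+[a/ℕn]*n a p) ⟩
      + (a ℤDM.%ℕ p) - (+ (a ℤDM.%ℕ p) + (a ℤDM./ℕ p) * + p)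
        ≡⟨ cancel (+ (a ℤDM.%ℕ p)) (a ℤDM./ℕ p) (+ p) ⟩
      - (a ℤDM./ℕ p) * + p ∎))
    where
    open ≡-Reasoning
    cancel : ∀ r x m → r - (r + x * m) ≡ - x * m
    cancel = solve-∀

  residue-injective : ∀ a b → residue a ≡ residue b → a ≡ b [mod p ]
  residue-injective a b eq =
    ≡mod-trans (≡mod-sym (residue-≡mod a)) (≡mod-trans (≡mod-reflexive (cong (λ x → + toℕ x) eq)) (residue-≡mod b))

  -- If t occurs m ≢ 0 (mod p) times in d, each rotation shifts positionSum d by m, so exactly one of
  -- the p rotations of d is anchored; this counts free rotation orbits without forming them.
  module _ (t : Fin N) where

    multiplicity : Colouring → ℤ
    multiplicity d = ∑[ i < p ] δ (d i) t

    positionSum : Colouring → ℤ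
    positionSum d = ∑[ i < p ] + toℕ i * δ (d i) t

    anchored : Colouring → ℤ
    anchored d = δ (residue (positionSum d)) Fin.zero

    multiplicity-csuc : ∀ d → multiplicity (d ∘ csuc) ≡ multiplicity d
    multiplicity-csuc d = ∑-permute p (λ i → δ (d i) t) csuc-injective

    positionSum-csuc : ∀ d → positionSum d ≡ positionSum (d ∘ csuc) + multiplicity d [mod p ]
    positionSum-csuc d = begin
      positionSum d
        ≡⟨ ∑-permute p (λ i → + toℕ i * δ (d i) t) csuc-injective ⟨
      ∑[ i < p ] + toℕ (csuc i) * δ (d (csuc i)) t
        ≈⟨ sumOver-≡mod (allFin p) (λ i → ≡mod-*ʳ _ (csuc-≡mod i)) ⟩
      ∑[ i < p ] (+ toℕ i + 1ℤ) * δ (d (csuc i)) t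
        ≡⟨ ∑-cong p (λ i → ℤ.*-distribʳ-+ (δ (d (csuc i)) t) (+ toℕ i) 1ℤ) ⟩
      ∑[ i < p ] (+ toℕ i * δ (d (csuc i)) t + 1ℤ * δ (d (csuc i)) t)
        ≡⟨ sumOver-distrib-+ (allFin p) (λ i → + toℕ i * δ (d (csuc i)) t) (λ i → 1ℤ * δ (d (csuc i)) t) ⟩
      positionSum (d ∘ csuc) + (∑[ i < p ] 1ℤ * δ (d (csuc i)) t)
        ≡⟨ cong (_+_ (positionSum (d ∘ csuc)))
            (trans (∑-cong p (λ i → ℤ.*-identityˡ (δ (d (csuc i)) t))) (multiplicity-csuc d)) ⟩
      positionSum (d ∘ csuc) + multiplicity d ∎
      where
      open SetoidReasoning ≡mod-setoid
      csuc-≡mod : ∀ i → + toℕ (csuc i) ≡ + toℕ i + 1ℤ [mod p ]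
      csuc-≡mod i = subst (λ x → + toℕ x ≡ + toℕ i + 1ℤ [mod p ]) (sym (csuc≡+mod1 i)) (toℕ-+mod-≡mod i 1)

    positionSum-rotate : ∀ j d → positionSum d ≡ positionSum (rotate j d) + + j * multiplicity d [mod p ]
    positionSum-rotate zero    d = ≡mod-reflexive
        (sym (trans (cong (_+_ (positionSum d)) (ℤ.*-zeroˡ (multiplicity d))) (ℤ.+-identityʳ _)))
    positionSum-rotate (suc j) d = begin
      positionSum d
        ≈⟨ positionSum-csuc d ⟩
      positionSum (d ∘ csuc) + multiplicity d
        ≈⟨ ≡mod-+ (positionSum-rotate j (d ∘ csuc)) ≡mod-refl ⟩
      positionSum (rotate j (d ∘ csuc)) + + j * multiplicity (d ∘ csuc) + multiplicity d
        ≡⟨ cong (λ m → positionSum (rotate (suc j) d) + + j * m + multiplicity d)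
            (multiplicity-csuc d) ⟩
      positionSum (rotate (suc j) d) + + j * multiplicity d + multiplicity d
        ≡⟨ regroup (positionSum (rotate (suc j) d)) (+ j) (multiplicity d) ⟩
      positionSum (rotate (suc j) d) + + suc j * multiplicity d ∎
      where
      open SetoidReasoning ≡mod-setoid
      regroup : ∀ l j m → l + j * m + m ≡ l + (1ℤ + j) * m
      regroup = solve-∀

    ∑-anchored-rotations : Prime p → ∀ d → ¬ (multiplicity d ≡ 0ℤ [mod p ]) →
                           ∑[ j < p ] anchored (rotate (toℕ j) d) ≡ 1ℤ
    ∑-anchored-rotations p-prime d m≢0 = begin
      ∑[ j < p ] δ (residueAt j) Fin.zero       ≡⟨ ∑-permute p (λ x → δ x Fin.zero) residueAt-injective ⟩
      ∑[ x < p ] δ x Fin.zero                   ≡⟨ ∑-cong p (λ x → sym (ℤ.*-identityʳ (δ x Fin.zero))) ⟩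
      ∑[ x < p ] δ x Fin.zero * 1ℤ              ≡⟨ ∑-δ p Fin.zero (const 1ℤ) ⟩
      1ℤ                                        ∎
      where
      open ≡-Reasoning
      residueAt : Fin p → Fin p
      residueAt j = residue (positionSum (rotate (toℕ j) d))
      residueAt-injective : IsPermutation residueAt
      residueAt-injective {j₁} {j₂} eq = ≡mod⇒≡ (≡mod-cancelʳ p-prime m≢0 (≡mod-+-cancelˡ
        (residue-injective (positionSum (rotate (toℕ j₁) d)) (positionSum (rotate (toℕ j₂) d)) eq)
        (≡mod-trans (≡mod-sym (positionSum-rotate (toℕ j₁) d)) (positionSum-rotate (toℕ j₂) d))))

    sumFuns-freeOrbits≡0 : Prime p → (G : Colouring → ℤ) → Extensional G → RotationInvariant G →
                 (∀ d → ¬ G d ≡ 0ℤ → ¬ (multiplicity d ≡ 0ℤ [mod p ])) → sumFuns p N G ≡ 0ℤ [mod p ]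
    sumFuns-freeOrbits≡0 p-prime G G-ext G-inv G≢0⇒m≢0 = ≡mod-trans (≡mod-reflexive (begin
      sumFuns p N G                                                ≡⟨ sumFuns-cong p N spread ⟩
      sumFuns p N (λ d → ∑[ j < p ] G d * anchored (rotate (toℕ j) d))  ≡⟨ sumOver-comm (allFuns p N) (allFin p) _ ⟩
      ∑[ j < p ] sumFuns p N (λ d → G d * anchored (rotate (toℕ j) d))  ≡⟨ ∑-cong p (λ j → rotations-agree (toℕ j)) ⟩
      ∑[ j < p ] X                                                 ≡⟨ ∑-const p X ⟩
      + p * X                                                      ≡⟨ ℤ.*-comm (+ p) X ⟩
      X * + p                                                      ∎)) (multiple≡0 X)
      where
      open ≡-Reasoning
      X : ℤ
      X = sumFuns p N (λ d → G d * anchored d)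
      spread : ∀ d → G d ≡ ∑[ j < p ] G d * anchored (rotate (toℕ j) d)
      spread d = sym (trans (sumOver-*ˡ (allFin p) (G d) (λ j → anchored (rotate (toℕ j) d))) (absorb d))
        where
        absorb : ∀ d → G d * (∑[ j < p ] anchored (rotate (toℕ j) d)) ≡ G d
        absorb d with G d ℤ.≟ 0ℤ
        ... | yes G≡0 = trans (cong (_* _) G≡0) (trans (ℤ.*-zeroˡ (∑[ j < p ] anchored (rotate (toℕ j) d))) (sym G≡0))
        ... | no G≢0  = trans (cong (_*_ (G d)) (∑-anchored-rotations p-prime d (G≢0⇒m≢0 d G≢0))) (ℤ.*-identityʳ (G d))
      rotations-agree : ∀ j → sumFuns p N (λ d → G d * anchored (rotate j d)) ≡ X
      rotations-agree zero    = refl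
      rotations-agree (suc j) =
        trans (sumFuns-cong p N (λ d → cong (_* anchored (rotate j (d ∘ csuc))) (sym (G-inv d))))
              (trans (sumFuns-rotate q N (λ d → G d * anchored (rotate j d))
                       (λ d≗d′ → cong₂ _*_ (G-ext d≗d′) (cong (λ x → δ (residue x) Fin.zero) (∑-cong p λ i →
                         cong (λ c → + toℕ i * δ c t) (rotate-cong j d≗d′ i)))))
                     (rotations-agree j))

  -- hasMax t d is 1 if t is the largest colour occurring in d and 0 otherwise: a rotation-invariant
  -- choice of the colour t above.
  allBelow : ℕ → Colouring → ℤ
  allBelow a d = ∏[ i < p ] 𝟙 (does (toℕ (d i) ℕ.<? a))

  hasMax : Fin N → Colouring → ℤ
  hasMax t d = allBelow (suc (toℕ t)) d - allBelow (toℕ t) d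

  allBelow-ext : ∀ a → Extensional (allBelow a)
  allBelow-ext a d≗d′ = ∏-cong p (λ i → cong (λ c → 𝟙 (does (toℕ c ℕ.<? a))) (d≗d′ i))

  allBelow-csuc : ∀ a d → allBelow a (d ∘ csuc) ≡ allBelow a d
  allBelow-csuc a d = ∏-permute p (λ i → 𝟙 (does (toℕ (d i) ℕ.<? a))) csuc-injective

  allBelow-all : ∀ {a} d → (∀ i → toℕ (d i) < a) → allBelow a d ≡ 1ℤ
  allBelow-all {a} d below = ∏-𝟙-all p (λ i → does (toℕ (d i) ℕ.<? a)) (λ i → dec-true (toℕ (d i) ℕ.<? a) (below i))

  allBelow-some : ∀ {a} d j → ¬ toℕ (d j) < a → allBelow a d ≡ 0ℤ
  allBelow-some {a} d j ¬below = ∏-𝟙-false p (λ i → does (toℕ (d i) ℕ.<? a)) j (dec-false (toℕ (d j) ℕ.<? a) ¬below)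

  ∑-hasMax : ∀ (d : Colouring) → ∑[ t < N ] hasMax t d ≡ 1ℤ
  ∑-hasMax d = trans (∑-telescope N (λ a → allBelow a d))
                     (cong₂ _-_ (allBelow-all {N} d (λ i → Fin.toℕ<n (d i))) (allBelow-some {0} d Fin.zero λ ()))

  hasMax-const : ∀ t → hasMax t (const t) ≡ 1ℤ
  hasMax-const t = cong₂ _-_ (allBelow-all (const t) (λ _ → ℕ.n<1+n (toℕ t)))
                             (allBelow-some (const t) Fin.zero (ℕ.n≮n (toℕ t)))

  hasMax-occurs : ∀ t d → ¬ hasMax t d ≡ 0ℤ → ∃ λ i → d i ≡ t
  hasMax-occurs t d hasMax≢0 with Fin.all? (λ i → toℕ (d i) ℕ.<? toℕ t)
  ... | yes all<t = contradiction (cong₂ _-_ (allBelow-all d (ℕ.m<n⇒m<1+n ∘ all<t)) (allBelow-all d all<t))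
                                  (hasMax≢0 ∘ flip trans (ℤ.+-inverseʳ 1ℤ))
  ... | no ¬all<t with Fin.¬∀⟶∃¬ p _ (λ i → toℕ (d i) ℕ.<? toℕ t) ¬all<t
  ...   | j , dⱼ≮t with Fin.all? (λ i → toℕ (d i) ℕ.<? suc (toℕ t))
  ...     | yes all≤t = j , Fin.toℕ-injective (ℕ.≤-antisym (ℕ.s≤s⁻¹ (all≤t j)) (ℕ.≮⇒≥ dⱼ≮t))
  ...     | no ¬all≤t =
    let (k , dₖ≰t) = Fin.¬∀⟶∃¬ p _ (λ i → toℕ (d i) ℕ.<? suc (toℕ t)) ¬all≤t
    in  contradiction (cong₂ _-_ (allBelow-some d k dₖ≰t) (allBelow-some d j dⱼ≮t)) hasMax≢0

  δᶠ-const-ext : ∀ t → Extensional (λ (d : Colouring) → δᶠ d (const t))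
  δᶠ-const-ext t d≗d′ = ∏-cong p (λ i → cong (λ c → δ c t) (d≗d′ i))

  δᶠ-const-csuc : ∀ t (d : Colouring) → δᶠ (d ∘ csuc) (const t) ≡ δᶠ d (const t)
  δᶠ-const-csuc t d = ∏-permute p (λ i → δ (d i) t) csuc-injective

  δᶠ-const-≢1 : ∀ t (d : Colouring) → ¬ δᶠ d (const t) ≡ 1ℤ → ∃ λ j → ¬ d j ≡ t
  δᶠ-const-≢1 t d δ≢1 with Fin.all? (λ i → d i Fin.≟ t)
  ... | yes all≡t = contradiction (∏-𝟙-all p (λ i → does (d i Fin.≟ t)) (λ i → dec-true (d i Fin.≟ t) (all≡t i)))
      δ≢1
  ... | no ¬all≡t = Fin.¬∀⟶∃¬ p _ (λ i → d i Fin.≟ t) ¬all≡t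

  multiplicity-≢0 : ∀ t d → (∃ λ i → d i ≡ t) → (∃ λ j → ¬ d j ≡ t) → ¬ (multiplicity t d ≡ 0ℤ [mod p ])
  multiplicity-≢0 t d (i , dᵢ≡t) (j , dⱼ≢t) (divides-difference p∣m) =
    ℕ.<⇒≢ (countTrue-positive p occurs i (dec-true (d i Fin.≟ t) dᵢ≡t))
          (sym (∣-small⇒≡0 (countTrue-< p occurs j (dec-false (d j Fin.≟ t) dⱼ≢t))
                           (subst (+ p DS.∣_) (trans (ℤ.+-identityʳ _) (∑-𝟙 p occurs)) p∣m)))
    where
    occurs : Fin p → Bool
    occurs i = does (d i Fin.≟ t)

  module _ (H : Colouring → ℤ) (H-ext : Extensional H) (t : Fin N) where

    withMax : Colouring → ℤ
    withMax d = H d * hasMax t d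

    nonconstantWithMax : Colouring → ℤ
    nonconstantWithMax d = withMax d * (1ℤ - δᶠ d (const t))

    withMax-ext : Extensional withMax
    withMax-ext d≗d′ = cong₂ _*_ (H-ext d≗d′)
        (cong₂ _-_ (allBelow-ext (suc (toℕ t)) d≗d′) (allBelow-ext (toℕ t) d≗d′))

    sumFuns-withMax : sumFuns p N withMax ≡ sumFuns p N nonconstantWithMax + H (const t)
    sumFuns-withMax = begin
      sumFuns p N withMax
        ≡⟨ sumFuns-cong p N (λ d → decompose (withMax d) (δᶠ d (const t))) ⟩
      sumFuns p N (λ d → nonconstantWithMax d + δᶠ d (const t) * withMax d)
        ≡⟨ sumOver-distrib-+ (allFuns p N) nonconstantWithMax _ ⟩
      sumFuns p N nonconstantWithMax + sumFuns p N (λ d → δᶠ d (const t) * withMax d)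
        ≡⟨ cong (_+_ (sumFuns p N nonconstantWithMax))
            (sumFuns-δᶠ p N (const t) withMax withMax-ext) ⟩
      sumFuns p N nonconstantWithMax + H (const t) * hasMax t (const t)
        ≡⟨ cong (λ x → sumFuns p N nonconstantWithMax + H (const t) * x)
            (hasMax-const t) ⟩
      sumFuns p N nonconstantWithMax + H (const t) * 1ℤ
        ≡⟨ cong (_+_ (sumFuns p N nonconstantWithMax)) (ℤ.*-identityʳ (H (const t))) ⟩
      sumFuns p N nonconstantWithMax + H (const t) ∎
      where
      open ≡-Reasoning
      decompose : ∀ g x → g ≡ g * (1ℤ - x) + x * g
      decompose = solve-∀

    sumFuns-nonconstantWithMax-≡0 : Prime p → RotationInvariant H → sumFuns p N nonconstantWithMax ≡ 0ℤ [mod p ]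
    sumFuns-nonconstantWithMax-≡0 p-prime H-inv = sumFuns-freeOrbits≡0 t p-prime nonconstantWithMax
      (λ d≗d′ → cong₂ _*_ (withMax-ext d≗d′) (cong (_-_ 1ℤ) (δᶠ-const-ext t d≗d′)))
      (λ d → cong₂ _*_ (cong₂ _*_ (H-inv d) (cong₂ _-_ (allBelow-csuc (suc (toℕ t)) d) (allBelow-csuc (toℕ t) d)))
                       (cong (_-_ 1ℤ) (δᶠ-const-csuc t d)))
      (λ d ≢0 → multiplicity-≢0 t d
        (hasMax-occurs t d (λ max≡0 → ≢0 (trans (cong (λ x → H d * x * (1ℤ - δᶠ d (const t))) max≡0)
                                                 (vanish (H d) (δᶠ d (const t))))))
        (δᶠ-const-≢1 t d (λ δ≡1 → ≢0 (trans (cong (λ x → withMax d * (1ℤ - x)) δ≡1) (ℤ.*-zeroʳ (withMax d))))))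
      where
      vanish : ∀ h x → h * 0ℤ * (1ℤ - x) ≡ 0ℤ
      vanish = solve-∀

  necklace-congruence : Prime p → (H : Colouring → ℤ) → Extensional H → RotationInvariant H →
                        sumFuns p N H ≡ ∑[ t < N ] H (const t) [mod p ]
  necklace-congruence p-prime H H-ext H-inv = begin
    sumFuns p N H
      ≡⟨ sumFuns-cong p N split-by-max ⟩
    sumFuns p N (λ d → ∑[ t < N ] withMax H H-ext t d)
      ≡⟨ sumOver-comm (allFuns p N) (allFin N) _ ⟩
    ∑[ t < N ] sumFuns p N (withMax H H-ext t)
      ≡⟨ ∑-cong N (sumFuns-withMax H H-ext) ⟩
    ∑[ t < N ] (sumFuns p N (nonconstantWithMax H H-ext t) + H (const t))
      ≈⟨ sumOver-≡mod (allFin N) (λ t →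
          ≡mod-+ (sumFuns-nonconstantWithMax-≡0 H H-ext t p-prime H-inv) ≡mod-refl) ⟩
    ∑[ t < N ] (0ℤ + H (const t))
      ≡⟨ ∑-cong N (λ t → ℤ.+-identityˡ (H (const t))) ⟩
    ∑[ t < N ] H (const t) ∎
    where
    open SetoidReasoning ≡mod-setoid
    split-by-max : ∀ d → H d ≡ ∑[ t < N ] withMax H H-ext t d
    split-by-max d = sym (trans (sumOver-*ˡ (allFin N) (H d) (λ t → hasMax t d))
                                (trans (cong (_*_ (H d)) (∑-hasMax d)) (ℤ.*-identityʳ (H d))))

-- Signs under cyclic shifts

sgn-cong : ∀ {n} {σ τ : Fin n → Fin n} → σ ≗ τ → sgn σ ≡ sgn τ
sgn-cong {n} σ≗τ = cong (λ m → if does (m % 2 ℕ.≟ 0) then 1ℤ else -1ℤ)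
  (cong ℕL.sum (List.map-cong (λ i → cong ℕL.sum (List.map-cong (λ j →
     cong₂ (λ a b → if does (i Fin.<? j) ∧ does (a Fin.<? b) then 1 else 0) (σ≗τ j) (σ≗τ i)) (allFin n))) (allFin n)))

sgn-≡ : ∀ {n} (σ τ : Fin n → Fin n) K → + inversions σ + + inversions τ ≡ + 2 * K → sgn σ ≡ sgn τ
sgn-≡ σ τ K eq = cong (λ m → if does (m ℕ.≟ 0) then 1ℤ else -1ℤ) (begin
  a % 2                    ≡⟨ ℕ.[m+kn]%n≡m%n a b 2 ⟨
  (a ℕ.+ b ℕ.* 2) % 2      ≡⟨ cong (_% 2) (trans (regroup a b) (cong (ℕ._+ b) a+b≡2k)) ⟩
  (2 ℕ.* k ℕ.+ b) % 2      ≡⟨ cong (_% 2) (swap k b) ⟩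
  (b ℕ.+ k ℕ.* 2) % 2      ≡⟨ ℕ.[m+kn]%n≡m%n b k 2 ⟩
  b % 2                    ∎)
  where
  open ≡-Reasoning
  a = inversions σ
  b = inversions τ
  k = ℤ.∣ K ∣
  a+b≡2k : a ℕ.+ b ≡ 2 ℕ.* k
  a+b≡2k = trans (cong ℤ.∣_∣ (trans (ℤ.pos-+ a b) eq)) (ℤ.abs-* (+ 2) K)
  regroup : ∀ a b → a ℕ.+ b ℕ.* 2 ≡ a ℕ.+ b ℕ.+ b
  regroup = ℕSolver.solve-∀
  swap : ∀ k b → 2 ℕ.* k ℕ.+ b ≡ b ℕ.+ k ℕ.* 2
  swap = ℕSolver.solve-∀

sgn-±1 : ∀ {n} (σ : Fin n → Fin n) → (sgn σ ≡ 1ℤ) ⊎ (sgn σ ≡ -1ℤ)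
sgn-±1 σ with does (inversions σ % 2 ℕ.≟ 0)
... | true  = inj₁ refl
... | false = inj₂ refl

module Inversions (q : ℕ) where

  private
    n = suc q

  ∑∑ : (Fin n → Fin n → ℤ) → ℤ
  ∑∑ f = ∑[ i < n ] ∑[ j < n ] f i j

  ∑∑-cong : ∀ {f g : Fin n → Fin n → ℤ} → (∀ i j → f i j ≡ g i j) → ∑∑ f ≡ ∑∑ g
  ∑∑-cong f≡g = ∑-cong n (λ i → ∑-cong n (f≡g i))

  ∑∑-distrib-+ : ∀ (f g : Fin n → Fin n → ℤ) → ∑∑ (λ i j → f i j + g i j) ≡ ∑∑ f + ∑∑ g
  ∑∑-distrib-+ f g = trans (∑-cong n (λ i → sumOver-distrib-+ (allFin n) (f i) (g i)))
      (sumOver-distrib-+ (allFin n) (λ i → ∑ n (f i)) (λ i → ∑ n (g i)))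

  ∑∑-*ˡ : ∀ c (f : Fin n → Fin n → ℤ) → ∑∑ (λ i j → c * f i j) ≡ c * ∑∑ f
  ∑∑-*ˡ c f = trans (∑-cong n (λ i → sumOver-*ˡ (allFin n) c (f i))) (sumOver-*ˡ (allFin n) c (λ i → ∑ n (f i)))

  ∑∑-symmetrise : ∀ (w : Fin n → ℤ) (T : Fin n → Fin n → ℤ) →
                  ∑∑ (λ i j → w i * T i j + w j * T i j) ≡ ∑[ k < n ] w k * (∑[ j < n ] (T k j + T j k))
  ∑∑-symmetrise w T = begin
    ∑∑ (λ i j → w i * T i j + w j * T i j)
      ≡⟨ ∑∑-distrib-+ (λ i j → w i * T i j) (λ i j → w j * T i j) ⟩
    ∑∑ (λ i j → w i * T i j) + ∑∑ (λ i j → w j * T i j)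
      ≡⟨ cong₂ _+_ (∑-cong n (λ i → sumOver-*ˡ (allFin n) (w i) (T i)))
          (sumOver-comm (allFin n) (allFin n) (λ i k → w k * T i k)) ⟩
    (∑[ k < n ] w k * (∑[ j < n ] T k j)) + (∑[ k < n ] ∑[ i < n ] w k * T i k)
      ≡⟨ cong (_+_ (∑[ k < n ] w k * (∑[ j < n ] T k j)))
          (∑-cong n (λ k → sumOver-*ˡ (allFin n) (w k) (λ i → T i k))) ⟩
    (∑[ k < n ] w k * (∑[ j < n ] T k j)) + (∑[ k < n ] w k * (∑[ j < n ] T j k))
      ≡⟨ sumOver-distrib-+ (allFin n) (λ k → w k * (∑[ j < n ] T k j)) (λ k → w k * (∑[ j < n ] T j k)) ⟨
    ∑[ k < n ] (w k * (∑[ j < n ] T k j) + w k * (∑[ j < n ] T j k))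
      ≡⟨ ∑-cong n (λ k →
          trans (sym (ℤ.*-distribˡ-+ (w k) (∑ n (T k)) (∑[ j < n ] T j k)))
          (cong (_*_ (w k)) (sym (sumOver-distrib-+ (allFin n) (T k) (λ j → T j k))))) ⟩
    ∑[ k < n ] w k * (∑[ j < n ] (T k j + T j k)) ∎
    where open ≡-Reasoning

  ltℕ : ℕ → ℕ → ℤ
  ltℕ a b = 𝟙 (does (a ℕ.<? b))

  lt : Fin n → Fin n → ℤ
  lt x y = ltℕ (toℕ x) (toℕ y)

  ltℕ-true : ∀ {a b} → a < b → ltℕ a b ≡ 1ℤ
  ltℕ-true {a} {b} a<b = cong 𝟙 (dec-true (a ℕ.<? b) a<b)

  ltℕ-false : ∀ {a b} → ¬ a < b → ltℕ a b ≡ 0ℤ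
  ltℕ-false {a} {b} a≮b = cong 𝟙 (dec-false (a ℕ.<? b) a≮b)

  lt-irrefl : ∀ x → lt x x ≡ 0ℤ
  lt-irrefl x = ltℕ-false (ℕ.n≮n (toℕ x))

  lt+lt≡1-δ : ∀ x y → lt x y + lt y x ≡ 1ℤ - δ x y
  lt+lt≡1-δ x y with ℕ.<-cmp (toℕ x) (toℕ y)
  ... | tri< x<y _ _ = trans (cong₂ _+_ (ltℕ-true x<y) (ltℕ-false (ℕ.<⇒≯ x<y)))
                             (cong (_-_ 1ℤ) (sym (δ-≢ (Fin.<⇒≢ x<y))))
  ... | tri≈ _ x≡y _ rewrite Fin.toℕ-injective x≡y = trans (cong₂ _+_ (lt-irrefl y) (lt-irrefl y))
                                                          (cong (_-_ 1ℤ) (sym (δ-refl y)))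
  ... | tri> _ _ y<x = trans (cong₂ _+_ (ltℕ-false (ℕ.<⇒≯ y<x)) (ltℕ-true y<x))
                             (cong (_-_ 1ℤ) (sym (δ-≢ (Fin.<⇒≢ y<x ∘ sym))))

  ∑-lt-both : ∀ {τ : Fin n → Fin n} → IsPermutation τ → ∀ k → ∑[ j < n ] (lt (τ k) (τ j) + lt (τ j) (τ k)) ≡ + q
  ∑-lt-both {τ} τ-perm k = begin
    ∑[ j < n ] (lt (τ k) (τ j) + lt (τ j) (τ k))
      ≡⟨ ∑-cong n (λ j → trans (lt+lt≡1-δ (τ k) (τ j)) (cong (_-_ 1ℤ) (δ-τ j))) ⟩
    ∑[ j < n ] (1ℤ - δ j k)
      ≡⟨ sumOver-distrib-- (allFin n) (const 1ℤ) (λ j → δ j k) ⟩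
    ∑ n (const 1ℤ) - (∑[ j < n ] δ j k)
      ≡⟨ cong₂ _-_ (∑-const n 1ℤ)
          (trans (∑-cong n (λ j → sym (ℤ.*-identityʳ (δ j k)))) (∑-δ n k (const 1ℤ))) ⟩
    + n * 1ℤ - 1ℤ
      ≡⟨ cancel (+ q) ⟩
    + q ∎
    where
    open ≡-Reasoning
    δ-τ : ∀ j → δ (τ k) (τ j) ≡ δ j k
    δ-τ j with j Fin.≟ k
    ... | yes refl = δ-refl (τ j)
    ... | no j≢k   = δ-≢ (j≢k ∘ sym ∘ τ-perm)
    cancel : ∀ x → (1ℤ + x) * 1ℤ - 1ℤ ≡ x
    cancel = solve-∀

  last : Fin n
  last = Fin.fromℕ q

  isLast : Fin n → ℤ
  isLast x = δ x last

  isLast-true : ∀ {x} → toℕ x ≡ q → isLast x ≡ 1ℤ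
  isLast-true {x} x≡q = trans (cong (λ y → δ y last) (Fin.toℕ-injective (trans x≡q (sym (Fin.toℕ-fromℕ q))))) (δ-refl last)

  isLast-false : ∀ {x} → toℕ x < q → isLast x ≡ 0ℤ
  isLast-false x<q = δ-≢ (λ x≡last → ℕ.<⇒≢ x<q (trans (cong toℕ x≡last) (Fin.toℕ-fromℕ q)))

  ∑-isLast : ∀ {σ : Fin n → Fin n} → IsPermutation σ → ∑[ k < n ] isLast (σ k) ≡ 1ℤ
  ∑-isLast σ-perm = trans (∑-permute n isLast σ-perm)
                          (trans (∑-cong n (λ x → sym (ℤ.*-identityʳ (isLast x)))) (∑-δ n last (const 1ℤ)))

  ltAvoidingLast : Fin n → Fin n → ℤ
  ltAvoidingLast x y = lt x y * (1ℤ - isLast x) * (1ℤ - isLast y)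

  private
    first-wraps : ∀ {a b c d} → a ≡ 1ℤ → b ≡ 0ℤ → c ≡ 1ℤ → d ≡ 0ℤ →
        a + b ≡ + 2 * (b * (1ℤ - c) * (1ℤ - d)) + c + d
    first-wraps refl refl refl refl = refl

    second-wraps : ∀ {a b c d} → a ≡ 0ℤ → b ≡ 1ℤ → c ≡ 0ℤ → d ≡ 1ℤ →
        a + b ≡ + 2 * (b * (1ℤ - c) * (1ℤ - d)) + c + d
    second-wraps refl refl refl refl = refl

    none-wraps : ∀ {a b c d} → a ≡ b → c ≡ 0ℤ → d ≡ 0ℤ → a + b ≡ + 2 * (b * (1ℤ - c) * (1ℤ - d)) + c + d
    none-wraps {b = b} refl refl refl = double b
      where
      double : ∀ b → b + b ≡ + 2 * (b * (1ℤ - 0ℤ) * (1ℤ - 0ℤ)) + 0ℤ + 0ℤ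
      double = solve-∀

    below-last : ∀ {y : Fin n} → toℕ (csuc y) ≡ suc (toℕ y) → toℕ y < q
    below-last {y} y↦suc = ℕ.s≤s⁻¹ (subst (_< n) y↦suc (Fin.toℕ<n (csuc y)))

  lt-csuc : ∀ {x y} → ¬ x ≡ y → lt (csuc x) (csuc y) + lt x y ≡ + 2 * ltAvoidingLast x y + isLast x + isLast y
  lt-csuc {x} {y} x≢y with csuc-view x | csuc-view y
  ... | inj₁ (x≡q , _)   | inj₁ (y≡q , _)   = contradiction (Fin.toℕ-injective (trans x≡q (sym y≡q))) x≢y
  ... | inj₁ (x≡q , x↦0) | inj₂ y↦suc       =
    first-wraps (cong₂ ltℕ (cong toℕ x↦0) y↦suc)
                (trans (cong (λ a → ltℕ a (toℕ y)) x≡q) (ltℕ-false (ℕ.<⇒≯ (below-last y↦suc))))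
                (isLast-true x≡q) (isLast-false (below-last y↦suc))
  ... | inj₂ x↦suc       | inj₁ (y≡q , y↦0) =
    second-wraps (cong₂ ltℕ x↦suc (cong toℕ y↦0))
                 (trans (cong (ltℕ (toℕ x)) y≡q) (ltℕ-true (below-last x↦suc)))
                 (isLast-false (below-last x↦suc)) (isLast-true y≡q)
  ... | inj₂ x↦suc       | inj₂ y↦suc       =
    none-wraps (cong₂ ltℕ x↦suc y↦suc) (isLast-false (below-last x↦suc)) (isLast-false (below-last y↦suc))

  I : (Fin n → Fin n) → ℤ
  I σ = ∑∑ (λ i j → lt i j * lt (σ j) (σ i))

  inversions≡I : ∀ σ → + inversions σ ≡ I σ
  inversions≡I σ = trans (sum-map≡sumOver (allFin n) _) (∑-cong n (λ i → trans (sum-map≡sumOver (allFin n) _)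
                     (∑-cong n (λ j → 𝟙-∧ (does (i Fin.<? j)) (does (σ j Fin.<? σ i))))))
    where
    𝟙-∧ : ∀ a b → + (if a ∧ b then 1 else 0) ≡ 𝟙 a * 𝟙 b
    𝟙-∧ true  true  = refl
    𝟙-∧ true  false = refl
    𝟙-∧ false b     = sym (ℤ.*-zeroˡ (𝟙 b))

  private
    vanish : ∀ a b c d e → a * 0ℤ + b * 0ℤ ≡ + 2 * (c * 0ℤ) + (d * 0ℤ + e * 0ℤ)
    vanish = solve-∀

    weighʳ : ∀ (i j : Fin n) a b c d e t → (i ≡ j → t ≡ 0ℤ) → (¬ i ≡ j → a + b ≡ + 2 * c + d + e) →
             a * t + b * t ≡ + 2 * (c * t) + (d * t + e * t)
    weighʳ i j a b c d e t diagonal off-diagonal with i Fin.≟ j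
    ... | yes i≡j rewrite diagonal i≡j = vanish a b c d e
    ... | no i≢j  = trans (sym (ℤ.*-distribʳ-+ t a b)) (trans (cong (_* t) (off-diagonal i≢j)) (spread c d e t))
      where
      spread : ∀ c d e t → (+ 2 * c + d + e) * t ≡ + 2 * (c * t) + (d * t + e * t)
      spread = solve-∀

    weighˡ : ∀ (i j : Fin n) a b c d e t → (i ≡ j → t ≡ 0ℤ) → (¬ i ≡ j → a + b ≡ + 2 * c + d + e) →
             t * a + t * b ≡ + 2 * (t * c) + (e * t + d * t)
    weighˡ i j a b c d e t diagonal off-diagonal =
      trans (cong₂ _+_ (ℤ.*-comm t a) (ℤ.*-comm t b))
            (trans (weighʳ i j a b c d e t diagonal off-diagonal) (swap c d e t))
      where
      swap : ∀ c d e t → + 2 * (c * t) + (d * t + e * t) ≡ + 2 * (t * c) + (e * t + d * t)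
      swap = solve-∀

  -- Moving position q to the front keeps the order of the pairs avoiding it and flips the q pairs
  -- through it; I-csuc∘ is the same count for values.
  I-∘csuc : ∀ {σ} → IsPermutation σ → ∃ λ K → I σ + I (σ ∘ csuc) ≡ + 2 * K + + q
  I-∘csuc {σ} σ-perm = K , (begin
    I σ + I (σ ∘ csuc)
      ≡⟨ cong (_+ I (σ ∘ csuc)) reindex ⟩
    ∑∑ (λ i j → lt (csuc i) (csuc j) * T i j) + ∑∑ (λ i j → lt i j * T i j)
      ≡⟨ ∑∑-distrib-+ (λ i j → lt (csuc i) (csuc j) * T i j) (λ i j → lt i j * T i j) ⟨
    ∑∑ (λ i j → lt (csuc i) (csuc j) * T i j + lt i j * T i j)
      ≡⟨ ∑∑-cong pointwise ⟩
    ∑∑ (λ i j → + 2 * (ltAvoidingLast i j * T i j) + (isLast i * T i j + isLast j * T i j))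
      ≡⟨ ∑∑-distrib-+ (λ i j → + 2 * (ltAvoidingLast i j * T i j)) (λ i j → isLast i * T i j + isLast j * T i j) ⟩
    ∑∑ (λ i j → + 2 * (ltAvoidingLast i j * T i j)) + ∑∑ (λ i j → isLast i * T i j + isLast j * T i j)
      ≡⟨ cong₂ _+_ (∑∑-*ˡ (+ 2) (λ i j → ltAvoidingLast i j * T i j)) (∑∑-symmetrise isLast T) ⟩
    + 2 * K + (∑[ k < n ] isLast k * (∑[ j < n ] (T k j + T j k)))
      ≡⟨ cong (_+_ (+ 2 * K)) (∑-δ n last (λ k → ∑[ j < n ] (T k j + T j k))) ⟩
    + 2 * K + (∑[ j < n ] (T last j + T j last))
      ≡⟨ cong (_+_ (+ 2 * K)) (trans (∑-cong n (λ j → ℤ.+-comm (T last j) (T j last)))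
          (∑-lt-both (csuc-injective ∘ σ-perm) last)) ⟩
    + 2 * K + + q ∎)
    where
    open ≡-Reasoning
    τ = σ ∘ csuc
    T : Fin n → Fin n → ℤ
    T i j = lt (τ j) (τ i)
    K : ℤ
    K = ∑∑ (λ i j → ltAvoidingLast i j * T i j)
    pointwise : ∀ i j → lt (csuc i) (csuc j) * T i j + lt i j * T i j ≡
                        + 2 * (ltAvoidingLast i j * T i j) + (isLast i * T i j + isLast j * T i j)
    pointwise i j = weighʳ i j (lt (csuc i) (csuc j)) (lt i j) (ltAvoidingLast i j) (isLast i) (isLast j) (T i j)
                           (λ { refl → lt-irrefl (τ i) }) lt-csuc
    reindex : I σ ≡ ∑∑ (λ i j → lt (csuc i) (csuc j) * T i j)
    reindex = sym (trans (∑-cong n (λ i → ∑-permute n (λ j → lt (csuc i) j * lt (σ j) (σ (csuc i))) csuc-injective))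
                         (∑-permute n (λ i → ∑[ j < n ] lt i j * lt (σ j) (σ i)) csuc-injective))

  I-csuc∘ : ∀ {σ} → IsPermutation σ → ∃ λ K → I (csuc ∘ σ) + I σ ≡ + 2 * K + + q
  I-csuc∘ {σ} σ-perm = K , (begin
    I (csuc ∘ σ) + I σ
      ≡⟨ ∑∑-distrib-+ (λ i j → lt i j * lt (csuc (σ j)) (csuc (σ i))) (λ i j → lt i j * lt (σ j) (σ i)) ⟨
    ∑∑ (λ i j → lt i j * lt (csuc (σ j)) (csuc (σ i)) + lt i j * lt (σ j) (σ i))
      ≡⟨ ∑∑-cong pointwise ⟩
    ∑∑ (λ i j → + 2 * (lt i j * ltAvoidingLast (σ j) (σ i)) + (isLast (σ i) * lt i j + isLast (σ j) * lt i j))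
      ≡⟨ ∑∑-distrib-+ (λ i j → + 2 * (lt i j * ltAvoidingLast (σ j) (σ i)))
          (λ i j → isLast (σ i) * lt i j + isLast (σ j) * lt i j) ⟩
    ∑∑ (λ i j → + 2 * (lt i j * ltAvoidingLast (σ j) (σ i))) + ∑∑ (λ i j → isLast (σ i) * lt i j + isLast (σ j) * lt i j)
      ≡⟨ cong₂ _+_ (∑∑-*ˡ (+ 2) (λ i j → lt i j * ltAvoidingLast (σ j) (σ i)))
          (∑∑-symmetrise (isLast ∘ σ) lt) ⟩
    + 2 * K + (∑[ k < n ] isLast (σ k) * (∑[ j < n ] (lt k j + lt j k)))
      ≡⟨ cong (_+_ (+ 2 * K)) (∑-cong n (λ k → cong (_*_ (isLast (σ k))) (∑-lt-both id k))) ⟩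
    + 2 * K + (∑[ k < n ] isLast (σ k) * + q)
      ≡⟨ cong (_+_ (+ 2 * K)) (trans (∑-cong n (λ k → ℤ.*-comm (isLast (σ k)) (+ q)))
          (sumOver-*ˡ (allFin n) (+ q) (isLast ∘ σ))) ⟩
    + 2 * K + + q * (∑[ k < n ] isLast (σ k))
      ≡⟨ cong (λ x → + 2 * K + + q * x) (∑-isLast σ-perm) ⟩
    + 2 * K + + q * 1ℤ
      ≡⟨ cong (_+_ (+ 2 * K)) (ℤ.*-identityʳ (+ q)) ⟩
    + 2 * K + + q ∎)
    where
    open ≡-Reasoning
    K : ℤ
    K = ∑∑ (λ i j → lt i j * ltAvoidingLast (σ j) (σ i))
    pointwise : ∀ i j → lt i j * lt (csuc (σ j)) (csuc (σ i)) + lt i j * lt (σ j) (σ i) ≡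
                        + 2 * (lt i j * ltAvoidingLast (σ j) (σ i)) + (isLast (σ i) * lt i j + isLast (σ j) * lt i j)
    pointwise i j = weighˡ i j (lt (csuc (σ j)) (csuc (σ i))) (lt (σ j) (σ i))
        (ltAvoidingLast (σ j) (σ i)) (isLast (σ j)) (isLast (σ i))
                           (lt i j) (λ { refl → lt-irrefl i }) (λ i≢j → lt-csuc (i≢j ∘ sym ∘ σ-perm))

  module _ (r : ℕ) (q≡r*2 : q ≡ r ℕ.* 2) where

    private
      same-sign : ∀ σ τ → (∃ λ K → I σ + I τ ≡ + 2 * K + + q) → sgn σ ≡ sgn τ
      same-sign σ τ (K , eq) = sgn-≡ σ τ (K + + r) (begin
        + inversions σ + + inversions τ   ≡⟨ cong₂ _+_ (inversions≡I σ) (inversions≡I τ) ⟩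
        I σ + I τ                         ≡⟨ eq ⟩
        + 2 * K + + q                     ≡⟨ cong (λ x → + 2 * K + + x) q≡r*2 ⟩
        + 2 * K + + (r ℕ.* 2)             ≡⟨ cong (_+_ (+ 2 * K)) (ℤ.pos-* r 2) ⟩
        + 2 * K + + r * + 2               ≡⟨ factor K (+ r) ⟩
        + 2 * (K + + r)                   ∎)
        where
        open ≡-Reasoning
        factor : ∀ k r → + 2 * k + r * + 2 ≡ + 2 * (k + r)
        factor = solve-∀

    sgn-∘csuc : ∀ {σ} → IsPermutation σ → sgn (σ ∘ csuc) ≡ sgn σ
    sgn-∘csuc {σ} σ-perm = sym (same-sign σ (σ ∘ csuc) (I-∘csuc σ-perm))

    sgn-csuc∘ : ∀ {σ} → IsPermutation σ → sgn (csuc ∘ σ) ≡ sgn σ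
    sgn-csuc∘ {σ} σ-perm = same-sign (csuc ∘ σ) σ (I-csuc∘ σ-perm)

and-tabulate : ∀ {A : Set} n (g : Fin n → A) (f : A → Bool) →
               (∀ i → f (g i) ≡ true) → foldr _∧_ true (map f (tabulate g)) ≡ true
and-tabulate zero    g f all = refl
and-tabulate (suc n) g f all rewrite all Fin.zero = and-tabulate n (g ∘ Fin.suc) f (all ∘ Fin.suc)

and-tabulate⁻ : ∀ {A : Set} n (g : Fin n → A) (f : A → Bool) →
                foldr _∧_ true (map f (tabulate g)) ≡ true → ∀ i → f (g i) ≡ true
and-tabulate⁻ (suc n) g f and≡true i with f (g Fin.zero) in f₀
and-tabulate⁻ (suc n) g f and≡true Fin.zero    | true = f₀
and-tabulate⁻ (suc n) g f and≡true (Fin.suc i) | true = and-tabulate⁻ n (g ∘ Fin.suc) f and≡true i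

isInjective⇒injective : ∀ {n} {σ : Fin n → Fin n} → isInjective σ ≡ true → IsPermutation σ
isInjective⇒injective {n} {σ} test {x} {y} σx≡σy
  with and-tabulate⁻ n id _ (and-tabulate⁻ n id _ test x) y
... | pass with x Fin.≟ y
...   | yes x≡y = x≡y
...   | no _ with σ x Fin.≟ σ y
...     | yes _    = case pass of λ ()
...     | no σx≢σy = contradiction σx≡σy σx≢σy

injective⇒isInjective : ∀ {n} {σ : Fin n → Fin n} → IsPermutation σ → isInjective σ ≡ true
injective⇒isInjective {n} {σ} σ-perm = and-tabulate n id _ (λ x → and-tabulate n id _ (λ y → pair x y))
  where
  pair : ∀ x y → (does (x Fin.≟ y) ∨ not (does (σ x Fin.≟ σ y))) ≡ true
  pair x y with x Fin.≟ y
  ... | yes _   = refl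
  ... | no x≢y with σ x Fin.≟ σ y
  ...   | yes σx≡σy = contradiction (σ-perm σx≡σy) x≢y
  ...   | no _      = refl

isInjective-≡ : ∀ {n} {σ τ : Fin n → Fin n} → (IsPermutation σ → IsPermutation τ) → (IsPermutation τ → IsPermutation σ) →
                isInjective σ ≡ isInjective τ
isInjective-≡ {σ = σ} {τ} σ⇒τ τ⇒σ with isInjective σ in σ-test | isInjective τ in τ-test
... | true  | true  = refl
... | false | false = refl
... | true  | false = sym (trans (sym τ-test) (injective⇒isInjective (σ⇒τ (isInjective⇒injective σ-test))))
... | false | true  = trans (sym σ-test) (injective⇒isInjective (τ⇒σ (isInjective⇒injective τ-test)))

IsPermutation-≗ : ∀ {n} {σ τ : Fin n → Fin n} → σ ≗ τ → IsPermutation σ → IsPermutation τ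
IsPermutation-≗ σ≗τ σ-perm {x} {y} τx≡τy = σ-perm (trans (σ≗τ x) (trans τx≡τy (sym (σ≗τ y))))

isInjective-cong : ∀ {n} {σ τ : Fin n → Fin n} → σ ≗ τ → isInjective σ ≡ isInjective τ
isInjective-cong σ≗τ = isInjective-≡ (IsPermutation-≗ σ≗τ) (IsPermutation-≗ (sym ∘ σ≗τ))

weight : ∀ {n} → Matrix n → (Fin n → Fin n) → ℤ
weight {n} A σ = ∏[ i < n ] A i (σ i)

sumℤ-perms : ∀ n (f : (Fin n → Fin n) → ℤ) → sumℤ (map f (perms n)) ≡ sumFuns n n (λ σ → 𝟙 (isInjective σ) * f σ)
sumℤ-perms n f = trans (sumℤ-map (perms n) f)
                       (trans (sumOver-filter (λ σ → T? (isInjective σ)) (allFuns n n) f)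
                              (sumFuns-cong n n (λ σ → cong (λ b → 𝟙 b * f σ) (does-T? (isInjective σ)))))
  where
  does-T? : ∀ b → does (T? b) ≡ b
  does-T? true  = refl
  does-T? false = refl

per≡sumFuns : ∀ {n} (A : Matrix n) → per A ≡ sumFuns n n (λ σ → 𝟙 (isInjective σ) * weight A σ)
per≡sumFuns {n} A = trans (cong sumℤ (List.map-cong (λ σ → prodℤ-map (allFin n) (λ i → A i (σ i))) (perms n)))
                          (sumℤ-perms n (weight A))

det≡sumFuns : ∀ {n} (A : Matrix n) → det A ≡ sumFuns n n (λ σ → 𝟙 (isInjective σ) * (sgn σ * weight A σ))
det≡sumFuns {n} A =
  trans (cong sumℤ (List.map-cong (λ σ → cong (_*_ (sgn σ)) (prodℤ-map (allFin n) (λ i → A i (σ i)))) (perms n)))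
        (sumℤ-perms n (λ σ → sgn σ * weight A σ))

-- Row-shifted matrices

module ShiftedMatrix {q k : ℕ} (0<k : 0 < k) (k<p : k < suc q)
                     (A : Matrix (suc q)) (A-01 : Is01 A) (shifted : KLeftRowShifted k A) where

  private
    p = suc q

  row₀ : Fin p → ℤ
  row₀ = A Fin.zero

  A≡row₀ : ∀ i j → A i j ≡ row₀ (j +mod (toℕ i ℕ.* k))
  A≡row₀ i j = shift-back (toℕ i) i j refl
    where
    shift-back : ∀ m i j → toℕ i ≡ m → A i j ≡ row₀ (j +mod (m ℕ.* k))
    shift-back zero    i j i≡0   = cong₂ A (Fin.toℕ-injective i≡0) (sym (+mod-zero j))
    shift-back (suc m) i j i≡1+m = begin
      A i j                                 ≡⟨ shifted i j ⟩
      A (pred-mod i) (j +mod k)             ≡⟨ shift-back m (pred-mod i) (j +mod k) (toℕ-pred-mod i i≡1+m) ⟩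
      row₀ ((j +mod k) +mod (m ℕ.* k))      ≡⟨ cong row₀ (+mod-+mod j k (m ℕ.* k)) ⟩
      row₀ (j +mod (suc m ℕ.* k))           ∎
      where open ≡-Reasoning

  twist : (Fin p → Fin p) → Fin p → Fin p
  twist d i = d i +mod (toℕ i ℕ.* (p ℕ.∸ k))

  A-twist : ∀ d i → A i (twist d i) ≡ row₀ (d i)
  A-twist d i = begin
    A i (twist d i)
      ≡⟨ A≡row₀ i (twist d i) ⟩
    row₀ ((d i +mod (toℕ i ℕ.* (p ℕ.∸ k))) +mod (toℕ i ℕ.* k))
      ≡⟨ cong row₀ (+mod-+mod (d i) (toℕ i ℕ.* (p ℕ.∸ k)) (toℕ i ℕ.* k)) ⟩
    row₀ (d i +mod (toℕ i ℕ.* (p ℕ.∸ k) ℕ.+ toℕ i ℕ.* k))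
      ≡⟨ cong (λ m → row₀ (d i +mod m)) full-turn ⟩
    row₀ (d i +mod (p ℕ.* toℕ i))
      ≡⟨ cong row₀ (+mod-multiple (d i) (toℕ i)) ⟩
    row₀ (d i) ∎
    where
    open ≡-Reasoning
    full-turn : toℕ i ℕ.* (p ℕ.∸ k) ℕ.+ toℕ i ℕ.* k ≡ p ℕ.* toℕ i
    full-turn = trans (sym (ℕ.*-distribˡ-+ (toℕ i) (p ℕ.∸ k) k))
                      (trans (cong (toℕ i ℕ.*_) (ℕ.m∸n+n≡m (ℕ.<⇒≤ k<p))) (ℕ.*-comm (toℕ i) p))

  twist-csuc : ∀ d → twist (d ∘ csuc) ≗ (_+mod k) ∘ twist d ∘ csuc
  twist-csuc d i = sym (begin
    (d (csuc i) +mod (toℕ (csuc i) ℕ.* (p ℕ.∸ k))) +mod k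
      ≡⟨ cong (_+mod k) (+mod-toℕ-csuc (d (csuc i)) i (p ℕ.∸ k)) ⟩
    (twist (d ∘ csuc) i +mod (p ℕ.∸ k)) +mod k
      ≡⟨ +mod-+mod (twist (d ∘ csuc) i) (p ℕ.∸ k) k ⟩
    twist (d ∘ csuc) i +mod (p ℕ.∸ k ℕ.+ k)
      ≡⟨ cong (twist (d ∘ csuc) i +mod_)
          (trans (ℕ.m∸n+n≡m (ℕ.<⇒≤ k<p)) (sym (ℕ.*-identityʳ p))) ⟩
    twist (d ∘ csuc) i +mod (p ℕ.* 1)
      ≡⟨ +mod-multiple (twist (d ∘ csuc) i) 1 ⟩
    twist (d ∘ csuc) i ∎)
    where open ≡-Reasoning

  twist-csuc-injective : ∀ d → IsPermutation (twist d) → IsPermutation (twist (d ∘ csuc))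
  twist-csuc-injective d twist-perm eq =
    csuc-injective (twist-perm (+mod-injective k (trans (sym (twist-csuc d _)) (trans eq (twist-csuc d _)))))

  twist-csuc-injective⁻ : ∀ d → IsPermutation (twist (d ∘ csuc)) → IsPermutation (twist d)
  twist-csuc-injective⁻ d twist′-perm {x} {y} eq
    with injective⇒surjective csuc-injective x | injective⇒surjective csuc-injective y
  ... | x′ , refl | y′ , refl = cong csuc (twist′-perm (trans (twist-csuc d x′)
      (trans (cong (_+mod k) eq) (sym (twist-csuc d y′)))))

  twist-const : ∀ c → twist (const c) ≗ (_+mod toℕ c) ∘ twist (const Fin.zero)
  twist-const c i = begin
    c +mod s                          ≡⟨ cong (_+mod s) c≡0+c ⟩
    (Fin.zero +mod toℕ c) +mod s      ≡⟨ +mod-+mod Fin.zero (toℕ c) s ⟩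
    Fin.zero +mod (toℕ c ℕ.+ s)       ≡⟨ cong (Fin.zero +mod_) (ℕ.+-comm (toℕ c) s) ⟩
    Fin.zero +mod (s ℕ.+ toℕ c)       ≡⟨ +mod-+mod Fin.zero s (toℕ c) ⟨
    (Fin.zero +mod s) +mod toℕ c      ∎
    where
    open ≡-Reasoning
    s = toℕ i ℕ.* (p ℕ.∸ k)
    c≡0+c : c ≡ Fin.zero +mod toℕ c
    c≡0+c = Fin.toℕ-injective (sym (trans (toℕ-+mod Fin.zero (toℕ c)) (ℕ.m<n⇒m%n≡m (Fin.toℕ<n c))))

  twist-const-injective : Prime p → ∀ c → IsPermutation (twist (const c))
  twist-const-injective p-prime c {x} {y} eq = ≡mod⇒≡ (≡mod-cancelʳ p-prime step≢0 (begin
    + toℕ x * + (p ℕ.∸ k)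
      ≡⟨ ℤ.pos-* (toℕ x) (p ℕ.∸ k) ⟨
    + (toℕ x ℕ.* (p ℕ.∸ k))
      ≈⟨ ≡mod-+-cancelˡ (≡mod-refl {a = + toℕ c})
          (≡mod-trans (≡mod-sym (toℕ-+mod-≡mod c (toℕ x ℕ.* (p ℕ.∸ k))))
          (≡mod-trans (≡mod-reflexive (cong (λ z → + toℕ z) eq)) (toℕ-+mod-≡mod c (toℕ y ℕ.* (p ℕ.∸ k))))) ⟩
    + (toℕ y ℕ.* (p ℕ.∸ k))
      ≡⟨ ℤ.pos-* (toℕ y) (p ℕ.∸ k) ⟩
    + toℕ y * + (p ℕ.∸ k) ∎))
    where
    open SetoidReasoning ≡mod-setoid
    step≢0 : ¬ (+ (p ℕ.∸ k) ≡ 0ℤ [mod p ])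
    step≢0 (divides-difference p∣step) = ℕ.<⇒≱ k<p (ℕ.m∸n≡0⇒m≤n
      (∣-small⇒≡0 (ℕ.∸-monoʳ-< {p} {k} {0} 0<k (ℕ.<⇒≤ k<p))
          (subst (+ p DS.∣_) (ℤ.+-identityʳ (+ (p ℕ.∸ k))) p∣step)))

  weight-twist : ∀ d → weight A (twist d) ≡ ∏[ i < p ] row₀ (d i)
  weight-twist d = ∏-cong p (A-twist d)

  weight-twist-csuc : ∀ d → weight A (twist (d ∘ csuc)) ≡ weight A (twist d)
  weight-twist-csuc d = trans (weight-twist (d ∘ csuc)) (trans (∏-permute p (row₀ ∘ d) csuc-injective) (sym (weight-twist d)))

  weight-twist-const : ∀ c → weight A (twist (const c)) ≡ row₀ c
  weight-twist-const c = trans (weight-twist (const c)) (∏-const-01 q (A-01 Fin.zero c))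
    where
    ∏-const-01 : ∀ m {x} → (x ≡ 0ℤ) ⊎ (x ≡ 1ℤ) → ∏ (suc m) (const x) ≡ x
    ∏-const-01 m (inj₁ refl) = trans (∏-suc m (const 0ℤ)) (ℤ.*-zeroˡ (∏ m (const 0ℤ)))
    ∏-const-01 m (inj₂ refl) = trans (∏-suc m (const 1ℤ)) (trans (ℤ.*-identityˡ _) (∏-ones m))
      where
      ∏-ones : ∀ m → ∏ m (const 1ℤ) ≡ 1ℤ
      ∏-ones zero    = refl
      ∏-ones (suc m) = trans (∏-suc m (const 1ℤ)) (trans (ℤ.*-identityˡ _) (∏-ones m))

  onesInRow0≡∑row₀ : + onesInRow0 A ≡ ∑[ j < p ] row₀ j
  onesInRow0≡∑row₀ = trans (length≡sumOver-1 (filter (λ j → A Fin.zero j ℤ.≟ 1ℤ) (allFin p)))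
                     (trans (sumOver-filter (λ j → A Fin.zero j ℤ.≟ 1ℤ) (allFin p) (const 1ℤ)) (∑-cong p indicator))
    where
    indicator : ∀ j → 𝟙 (does (row₀ j ℤ.≟ 1ℤ)) * 1ℤ ≡ row₀ j
    indicator j with A-01 Fin.zero j
    ... | inj₁ A₀ⱼ≡0 rewrite A₀ⱼ≡0 = refl
    ... | inj₂ A₀ⱼ≡1 rewrite A₀ⱼ≡1 = refl

  isInjective-twist-csuc : ∀ d → isInjective (twist (d ∘ csuc)) ≡ isInjective (twist d)
  isInjective-twist-csuc d = isInjective-≡ (twist-csuc-injective⁻ d) (twist-csuc-injective d)

  -- χ is const 1ℤ for the permanent and sgn for the determinant.
  summand : ((Fin p → Fin p) → ℤ) → (Fin p → Fin p) → ℤ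
  summand χ σ = 𝟙 (isInjective σ) * (χ σ * weight A σ)

  module _ (χ : (Fin p → Fin p) → ℤ) (χ-cong : ∀ {σ τ} → σ ≗ τ → χ σ ≡ χ τ)
           (χ-csuc∘ : ∀ {σ} → IsPermutation σ → χ (csuc ∘ σ) ≡ χ σ)
           (χ-∘csuc : ∀ {σ} → IsPermutation σ → χ (σ ∘ csuc) ≡ χ σ) where

    χ-+mod∘ : ∀ m {σ} → IsPermutation σ → χ ((_+mod m) ∘ σ) ≡ χ σ
    χ-+mod∘ zero    {σ} σ-perm = χ-cong (λ i → +mod-zero (σ i))
    χ-+mod∘ (suc m) {σ} σ-perm =
      trans (χ-cong (λ i → +mod-suc (σ i) m)) (trans (χ-csuc∘ (σ-perm ∘ +mod-injective m)) (χ-+mod∘ m σ-perm))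

    summand-cong : ∀ {σ τ} → σ ≗ τ → summand χ σ ≡ summand χ τ
    summand-cong σ≗τ = cong₂ _*_ (cong 𝟙 (isInjective-cong σ≗τ))
        (cong₂ _*_ (χ-cong σ≗τ) (∏-cong p (λ i → cong (A i) (σ≗τ i))))

    summand-twist-csuc : ∀ d → summand χ (twist (d ∘ csuc)) ≡ summand χ (twist d)
    summand-twist-csuc d with isInjective (twist d) in test
    ... | false = trans (cong (λ b → 𝟙 b * rest) (trans (isInjective-twist-csuc d) test)) (ℤ.*-zeroˡ rest)
      where rest = χ (twist (d ∘ csuc)) * weight A (twist (d ∘ csuc))
    ... | true  = cong₂ _*_ (cong 𝟙 (trans (isInjective-twist-csuc d) test)) (cong₂ _*_ χ-twist (weight-twist-csuc d))
      where
      twist-perm = isInjective⇒injective test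
      χ-twist : χ (twist (d ∘ csuc)) ≡ χ (twist d)
      χ-twist = trans (χ-cong (twist-csuc d)) (trans (χ-+mod∘ k (csuc-injective ∘ twist-perm)) (χ-∘csuc twist-perm))

    summand-twist-const : Prime p → ∀ c → summand χ (twist (const c)) ≡ χ (twist (const Fin.zero)) * row₀ c
    summand-twist-const p-prime c = begin
      summand χ (twist (const c))
        ≡⟨ cong (λ b → 𝟙 b * (χ (twist (const c)) * weight A (twist (const c))))
            (injective⇒isInjective (twist-const-injective p-prime c)) ⟩
      1ℤ * (χ (twist (const c)) * weight A (twist (const c)))
        ≡⟨ ℤ.*-identityˡ (χ (twist (const c)) * weight A (twist (const c))) ⟩
      χ (twist (const c)) * weight A (twist (const c))
        ≡⟨ cong₂ _*_ χ-const (weight-twist-const c) ⟩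
      χ (twist (const Fin.zero)) * row₀ c ∎
      where
      open ≡-Reasoning
      χ-const : χ (twist (const c)) ≡ χ (twist (const Fin.zero))
      χ-const = trans (χ-cong (twist-const c)) (χ-+mod∘ (toℕ c) (twist-const-injective p-prime Fin.zero))

    sumFuns-summand≡ : Prime p → sumFuns p p (summand χ) ≡ χ (twist (const Fin.zero)) * + onesInRow0 A [mod p ]
    sumFuns-summand≡ p-prime = begin
      sumFuns p p (summand χ)
        ≡⟨ sumFuns-reindex p p (summand χ) summand-cong
            (λ i x → twist (const x) i) (λ i → +mod-injective (toℕ i ℕ.* (p ℕ.∸ k))) ⟩
      sumFuns p p (summand χ ∘ twist)
        ≈⟨ necklace-congruence p-prime (summand χ ∘ twist) (summand-cong ∘ twist-cong) summand-twist-csuc ⟩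
      ∑[ c < p ] summand χ (twist (const c))
        ≡⟨ ∑-cong p (summand-twist-const p-prime) ⟩
      ∑[ c < p ] χ (twist (const Fin.zero)) * row₀ c
        ≡⟨ sumOver-*ˡ (allFin p) (χ (twist (const Fin.zero))) row₀ ⟩
      χ (twist (const Fin.zero)) * (∑[ c < p ] row₀ c)
        ≡⟨ cong (_*_ (χ (twist (const Fin.zero)))) onesInRow0≡∑row₀ ⟨
      χ (twist (const Fin.zero)) * + onesInRow0 A ∎
      where
      open SetoidReasoning ≡mod-setoid
      open Necklace q p using (necklace-congruence)
      twist-cong : ∀ {d d′} → d ≗ d′ → twist d ≗ twist d′
      twist-cong d≗d′ i = cong (_+mod (toℕ i ℕ.* (p ℕ.∸ k))) (d≗d′ i)

  per≡onesInRow0 : Prime p → per A ≡ + onesInRow0 A [mod p ]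
  per≡onesInRow0 p-prime = begin
    per A
      ≡⟨ per≡sumFuns A ⟩
    sumFuns p p (λ σ → 𝟙 (isInjective σ) * weight A σ)
      ≡⟨ sumFuns-cong p p (λ σ → cong (_*_ (𝟙 (isInjective σ))) (sym (ℤ.*-identityˡ (weight A σ)))) ⟩
    sumFuns p p (summand (const 1ℤ))
      ≈⟨ sumFuns-summand≡ (const 1ℤ) (λ _ → refl) (λ _ → refl) (λ _ → refl) p-prime ⟩
    1ℤ * + onesInRow0 A
      ≡⟨ ℤ.*-identityˡ (+ onesInRow0 A) ⟩
    + onesInRow0 A ∎
    where open SetoidReasoning ≡mod-setoid

  det≡sgn*onesInRow0 : Prime p → ∀ r → q ≡ r ℕ.* 2 → det A ≡ sgn (twist (const Fin.zero)) * + onesInRow0 A [mod p ]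
  det≡sgn*onesInRow0 p-prime r q≡r*2 = ≡mod-trans (≡mod-reflexive (det≡sumFuns A))
    (sumFuns-summand≡ sgn sgn-cong (Inversions.sgn-csuc∘ q r q≡r*2) (Inversions.sgn-∘csuc q r q≡r*2) p-prime)

  det≡±onesInRow0 : Prime p → ∀ r → q ≡ r ℕ.* 2 →
      (det A ≡ + onesInRow0 A [mod p ]) ⊎ (det A ≡ - + onesInRow0 A [mod p ])
  det≡±onesInRow0 p-prime r q≡r*2 with sgn-±1 (twist (const Fin.zero))
  ... | inj₁ ε≡1  = inj₁ (≡mod-trans (det≡sgn*onesInRow0 p-prime r q≡r*2)
                                     (≡mod-reflexive (trans (cong (_* + onesInRow0 A) ε≡1) (ℤ.*-identityˡ (+ onesInRow0 A)))))
  ... | inj₂ ε≡-1 = inj₂ (≡mod-trans (det≡sgn*onesInRow0 p-prime r q≡r*2)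
                                     (≡mod-reflexive (trans (cong (_* + onesInRow0 A) ε≡-1) (ℤ.-1*i≡-i (+ onesInRow0 A)))))

lemma2 : (p : ℕ) .{{_ : NonZero p}} → Prime p → p % 2 ≡ 1 →
         (k : ℕ) → 0 < k → k < p →
         (A : Matrix p) → Is01 A → KLeftRowShifted k A →
         ((+ p) ∣ (per A - + onesInRow0 A))
         × (((+ p) ∣ (det A - + onesInRow0 A)) ⊎ ((+ p) ∣ (det A - (- + onesInRow0 A))))
lemma2 (suc q) p-prime p-odd k 0<k k<p A A-01 shifted =
  unsigned (per≡onesInRow0 p-prime) , Sum.map unsigned unsigned (det≡±onesInRow0 p-prime (suc q ℕ./ 2) q-even)
  where
  open ShiftedMatrix 0<k k<p A A-01 shifted
  unsigned : ∀ {a b} → a ≡ b [mod suc q ] → + suc q ∣ a - b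
  unsigned = DS.∣⇒∣ᵤ ∘ divides
  q-even : q ≡ suc q ℕ./ 2 ℕ.* 2
  q-even = ℕ.suc-injective (trans (ℕ.m≡m%n+[m/n]*n (suc q) 2) (cong (ℕ._+ suc q ℕ./ 2 ℕ.* 2) p-odd))
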